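{- Let $r\ge3$ and $k\ge2$ be integers. If $n\ge 3(k-1)(r-1)$, then the complete graph $K_n$ is $(r,k)$-canceling.
   Context: Given an edge coloring $\chi:E(G)\to\{1,\dots,r\}$, a path $P$ is canceling if every color is used by the same number of edges of $P$. The coloring $\chi$ is $(r,k)$-canceling if for every $u,v\in V(G)$ and every set $S\subseteq V(G)\setminus\{u,v\}$ with $|S|<k$, there is a canceling path from $u$ to $v$ in $G-S$. A graph $G$ is $(r,k)$-canceling if it admits an $(r,k)$-canceling edge coloring. -}

module Defs where

open import Data.Nat using (ℕ; _<_)
open import Data.Fin using (Fin)
open import Data.Fin.Properties using (_≟_)
open import Data.Fin.Subset using (Subset; _∈_; _∉_; ∣_∣)
open import Data.List using (List; []; _∷_; length; filter)
open import Data.List.Relation.Unary.All using (All)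
open import Data.List.Relation.Unary.Unique.Propositional using (Unique)
open import Data.Product using (Σ; _×_; ∃-syntax)
open import Relation.Binary.PropositionalEquality using (_≡_)
open import Relation.Nullary using (¬_)

-- An r-edge-colouring of the complete graph K_n on vertex set Fin n:
-- a symmetric function assigning to each pair {x,y} (x ≠ y) a colour in Fin r.
-- (Values on the diagonal are irrelevant: K_n has no loops and a path never
-- uses them.)
record EdgeColouring (n r : ℕ) : Set where
  field
    colour    : Fin n → Fin n → Fin r
    symmetric : ∀ x y → colour x y ≡ colour y x
open EdgeColouring public

-- A path in K_n is given by its start vertex x and the list of the remaining
-- vertices; it is a path iff all vertices are distinct (every pair of distinct
-- vertices is adjacent in K_n).
endpoint : ∀ {n} → Fin n → List (Fin n) → Fin n
endpoint x []       = x
endpoint x (y ∷ ys) = endpoint y ys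

edgeColours : ∀ {n r} → EdgeColouring n r → Fin n → List (Fin n) → List (Fin r)
edgeColours χ x []       = []
edgeColours χ x (y ∷ ys) = colour χ x y ∷ edgeColours χ y ys

countColour : ∀ {r} → Fin r → List (Fin r) → ℕ
countColour i cs = length (filter (_≟ i) cs)

Canceling : ∀ {r} → List (Fin r) → Set
Canceling {r} cs = ∀ (i j : Fin r) → countColour i cs ≡ countColour j cs

CancelingPathAvoiding : ∀ {n r} → EdgeColouring n r → Subset n → Fin n → Fin n → Set
CancelingPathAvoiding χ S u v =
  ∃[ rest ] (Unique (u ∷ rest) × endpoint u rest ≡ v ×
             All (_∉ S) (u ∷ rest) × Canceling (edgeColours χ u rest))

IsCancelingColouring : ∀ {n r} → ℕ → EdgeColouring n r → Set
IsCancelingColouring {n} k χ =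
  ∀ (u v : Fin n) (S : Subset n) → u ∉ S → v ∉ S → ∣ S ∣ < k →
    CancelingPathAvoiding χ S u v

CompleteIsCanceling : (n r k : ℕ) → Set
CompleteIsCanceling n r k = Σ (EdgeColouring n r) (IsCancelingColouring k)

-- Colour K_n by residue classes: x gets class x mod m, and the edge xy the colour of the
-- classes of x and y in a pattern colouring of the complete graph with loops on m classes.
-- Suppose the pattern has, for all classes a and b, an a–b walk whose edges carry every colour
-- exactly once and which visits each class at most twice.  Given u, v and a set S of fewer than
-- k deleted vertices, follow the walk from the class of u to the class of v, choosing a fresh
-- vertex in each class: when a class is entered, at most one of its vertices is already used,
-- so if every class has k + 1 vertices (m (k + 1) ≤ n) one of them is neither used nor in S.
-- The resulting u–v path is rainbow, hence canceling.
--
-- Patterns with m = r = 3 and with (r, m) = (5, 4) are checked by computation.  A pattern grows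
-- by one colour and one class by adding a twin of a hub class: the twin copies the hub's
-- colours, except that its edges to itself and to the hub get the new colour, and each walk
-- takes the twin in at an edge with exactly one end at the hub.  This gives patterns with
-- m = r for r = 4 and m = r − 1 for r ≥ 5, enough for n ≥ 3 (k − 1) (r − 1) except when k = 2
-- and (r, n) is (3, 6), (3, 7), (3, 8), (4, 9), (4, 10) or (4, 11).  There, since ∣ S ∣ ≤ 1,
-- it suffices to list for each u ≠ v canceling u–v paths avoiding each single other vertex;
-- these tables are checked by computation.

module Submission where

open import Defs
open import Data.Empty using (⊥-elim)
open import Data.Fin using (Fin; zero; suc; toℕ; fromℕ<)
open import Data.Fin.Properties using (_≟_; 0≢1+n; toℕ-injective; toℕ-fromℕ<; toℕ<n; any?; all?)
open import Data.Fin.Subset using (Subset; _∈_; _∉_; ∣_∣; _-_)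
open import Data.Fin.Subset.Properties using (_∈?_; x∈p∧x≢y⇒x∈p-y; x∈p⇒∣p-x∣<∣p∣)
open import Data.List using (List; []; _∷_; _++_; _∷ʳ_; [_]; head; length; filter; map; tabulate)
open import Data.List.Membership.Propositional using (find) renaming (_∈_ to _∈ₗ_; _∉_ to _∉ₗ_)
open import Data.List.Membership.Propositional.Properties using (∈-map⁺)
open import Data.List.Properties
  using (≡-dec; filter-++; length-++; filter-accept; filter-some; length-tabulate; map-++; ++-assoc; ++-identityʳ; ++-conicalʳ)
open import Data.List.Relation.Binary.Permutation.Propositional
  using (_↭_; ↭-sym; ↭-refl; ↭-reflexive; ↭-prep; ↭-swap; ↭⇒↭ₛ; module PermutationReasoning)
open import Data.List.Relation.Binary.Permutation.Propositional.Properties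
  using (↭-length; filter-↭; shift; ∷↭∷ʳ; All-resp-↭; ++⁺ˡ)
import Data.List.Relation.Binary.Permutation.Setoid.Properties as PermutationSetoid
open import Data.List.Relation.Unary.All as All using (All; []; _∷_)
open import Data.List.Relation.Unary.All.Properties using (¬Any⇒All¬; tabulate⁺)
open import Data.List.Relation.Unary.AllPairs using ([]; _∷_; allPairs?)
open import Data.List.Relation.Unary.Any as Any using (Any; here; there)
open import Data.List.Relation.Unary.Unique.Propositional using (Unique)
import Data.List.Relation.Unary.Unique.Propositional.Properties as Unique
open import Data.Maybe using (fromMaybe)
open import Data.Nat using (ℕ; zero; suc; _+_; _*_; _∸_; _%_; _≤_; _<_; _≤?_; z≤n; s≤s; NonZero)
open import Data.Nat.DivMod using (_mod_; [m+kn]%n≡m%n; m<n⇒m%n≡m)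
import Data.Nat.Properties as ℕ
open import Data.Nat.Tactic.RingSolver using (solve-∀)
open import Data.Product using (_×_; _,_; ∃-syntax)
open import Data.Sum using (_⊎_; inj₁; inj₂)
open import Data.Vec using (Vec; []; _∷_; lookup)
open import Function using (case_of_)
open import Relation.Binary.PropositionalEquality
  using (_≡_; _≢_; refl; setoid; sym; trans; cong; cong₂; subst; module ≡-Reasoning)
open import Relation.Nullary using (¬_; Dec; yes; no; ¬?)
open import Relation.Nullary.Decidable using (_×-dec_; _⊎-dec_; _→-dec_; from-yes)

private variable
  n m r : ℕ

countColour-++ : (i : Fin r) (xs ys : List (Fin r)) →
                 countColour i (xs ++ ys) ≡ countColour i xs + countColour i ys
countColour-++ i xs ys = trans (cong length (filter-++ (_≟ i) xs ys)) (length-++ (filter (_≟ i) xs))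

countColour-↭ : (i : Fin r) {xs ys : List (Fin r)} → xs ↭ ys → countColour i xs ≡ countColour i ys
countColour-↭ i xs↭ys = ↭-length (filter-↭ (_≟ i) xs↭ys)

countColour-map-suc : (i : Fin r) (xs : List (Fin r)) → countColour (suc i) (map suc xs) ≡ countColour i xs
countColour-map-suc i []       = refl
countColour-map-suc i (x ∷ xs) with x ≟ i
... | yes _ = cong suc (countColour-map-suc i xs)
... | no _  = countColour-map-suc i xs

countColour-zero-map-suc : (xs : List (Fin r)) → countColour zero (map suc xs) ≡ 0
countColour-zero-map-suc []       = refl
countColour-zero-map-suc (x ∷ xs) = countColour-zero-map-suc xs

countColour-∷ : (i : Fin r) (cs : List (Fin r)) → countColour i (i ∷ cs) ≡ suc (countColour i cs)
countColour-∷ i cs = cong length (filter-accept (_≟ i) refl)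

countColour-∷-≤ : (i c : Fin r) (cs : List (Fin r)) → countColour i cs ≤ countColour i (c ∷ cs)
countColour-∷-≤ i c cs = subst (countColour i cs ≤_) (sym (countColour-++ i [ c ] cs)) (ℕ.m≤n+m _ _)

countColour-∈ : {i : Fin r} {cs : List (Fin r)} → i ∈ₗ cs → 0 < countColour i cs
countColour-∈ i∈cs = filter-some (_≟ _) (Any.map sym i∈cs)

Rainbow : List (Fin r) → Set
Rainbow cs = ∀ i → countColour i cs ≡ 1

Rainbow⇒Canceling : {cs : List (Fin r)} → Rainbow cs → Canceling cs
Rainbow⇒Canceling ρ i j = trans (ρ i) (sym (ρ j))

Rainbow-↭ : {xs ys : List (Fin r)} → xs ↭ ys → Rainbow xs → Rainbow ys
Rainbow-↭ xs↭ys ρ i = trans (sym (countColour-↭ i xs↭ys)) (ρ i)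

Rainbow-zero∷map-suc : {cs : List (Fin r)} → Rainbow cs → Rainbow (zero ∷ map suc cs)
Rainbow-zero∷map-suc {cs = cs} ρ zero    = cong suc (countColour-zero-map-suc cs)
Rainbow-zero∷map-suc {cs = cs} ρ (suc i) = trans (countColour-map-suc i cs) (ρ i)

AtMostTwice : List (Fin m) → Set
AtMostTwice xs = ∀ c → countColour c xs ≤ 2

AtMostTwice-↭ : {xs ys : List (Fin m)} → xs ↭ ys → AtMostTwice xs → AtMostTwice ys
AtMostTwice-↭ xs↭ys μ c = subst (_≤ 2) (countColour-↭ c xs↭ys) (μ c)

AtMostTwice-∷⁻ : {x : Fin m} {xs : List (Fin m)} → AtMostTwice (x ∷ xs) → AtMostTwice xs
AtMostTwice-∷⁻ {x = x} {xs} μ c = ℕ.≤-trans (countColour-∷-≤ c x xs) (μ c)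

AtMostTwice-zero∷zero∷map-suc : {xs : List (Fin m)} → AtMostTwice xs → AtMostTwice (zero ∷ zero ∷ map suc xs)
AtMostTwice-zero∷zero∷map-suc {xs = xs} μ zero    = s≤s (s≤s (ℕ.≤-reflexive (countColour-zero-map-suc xs)))
AtMostTwice-zero∷zero∷map-suc {xs = xs} μ (suc c) = subst (_≤ 2) (sym (countColour-map-suc c xs)) (μ c)

AtMostTwice-zero∷map-suc : {xs : List (Fin m)} → AtMostTwice xs → AtMostTwice (zero ∷ map suc xs)
AtMostTwice-zero∷map-suc {xs = xs} μ = AtMostTwice-∷⁻ {x = zero} (AtMostTwice-zero∷zero∷map-suc {xs = xs} μ)

endpoint-++ : (x : Fin n) (ys zs : List (Fin n)) → endpoint x (ys ++ zs) ≡ endpoint (endpoint x ys) zs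
endpoint-++ x []       zs = refl
endpoint-++ x (y ∷ ys) zs = endpoint-++ y ys zs

endpoint-∷ʳ : (x : Fin n) (ys : List (Fin n)) (v : Fin n) → endpoint x (ys ∷ʳ v) ≡ v
endpoint-∷ʳ x ys v = endpoint-++ x ys [ v ]

endpoint-map : (f : Fin n → Fin m) (x : Fin n) (ys : List (Fin n)) → endpoint (f x) (map f ys) ≡ f (endpoint x ys)
endpoint-map f x []       = refl
endpoint-map f x (y ∷ ys) = endpoint-map f y ys

endpoint-∈ : (x y : Fin n) (ys : List (Fin n)) → endpoint x (y ∷ ys) ∈ₗ y ∷ ys
endpoint-∈ x y []       = here refl
endpoint-∈ x y (z ∷ ys) = there (endpoint-∈ y z ys)

edgeColours-++ : (χ : EdgeColouring n r) (x : Fin n) (ys zs : List (Fin n)) →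
                 edgeColours χ x (ys ++ zs) ≡ edgeColours χ x ys ++ edgeColours χ (endpoint x ys) zs
edgeColours-++ χ x []       zs = refl
edgeColours-++ χ x (y ∷ ys) zs = cong (colour χ x y ∷_) (edgeColours-++ χ y ys zs)

pullback : EdgeColouring m r → (Fin n → Fin m) → EdgeColouring n r
pullback χ f = record { colour = λ x y → colour χ (f x) (f y) ; symmetric = λ x y → symmetric χ (f x) (f y) }

edgeColours-pullback : (χ : EdgeColouring m r) (f : Fin n → Fin m) (x : Fin n) (ys : List (Fin n)) →
                       edgeColours (pullback χ f) x ys ≡ edgeColours χ (f x) (map f ys)
edgeColours-pullback χ f x []       = refl
edgeColours-pullback χ f x (y ∷ ys) = cong (colour χ (f x) (f y) ∷_) (edgeColours-pullback χ f y ys)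

Unique-resp-↭ : {xs ys : List (Fin n)} → xs ↭ ys → Unique xs → Unique ys
Unique-resp-↭ {n = n} xs↭ys = Unique-resp-↭ₛ (↭⇒↭ₛ xs↭ys)
  where open PermutationSetoid (setoid (Fin n)) renaming (Unique-resp-↭ to Unique-resp-↭ₛ)

_∈ₗ?_ : (x : Fin n) (xs : List (Fin n)) → Dec (x ∈ₗ xs)
x ∈ₗ? xs = Any.any? (x ≟_) xs

uniqueIn⇒length≤∣∣ : (S : Subset n) {xs : List (Fin n)} → Unique xs → All (_∈ S) xs → length xs ≤ ∣ S ∣
uniqueIn⇒length≤∣∣ S {[]}     []                []             = z≤n
uniqueIn⇒length≤∣∣ S {x ∷ xs} (x≢xs ∷ uniqueXs) (x∈S ∷ xs⊆S) =
  ℕ.≤-trans (s≤s (uniqueIn⇒length≤∣∣ (S - x) uniqueXs (All.zipWith removeHead (x≢xs , xs⊆S))))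
            (x∈p⇒∣p-x∣<∣p∣ x∈S)
  where removeHead : ∀ {y} → x ≢ y × y ∈ S → y ∈ S - x
        removeHead (x≢y , y∈S) = x∈p∧x≢y⇒x∈p-y y∈S (λ y≡x → x≢y (sym y≡x))

uniqueIn∪subsingleton⇒length≤1+∣∣ : (S : Subset n) {P : Fin n → Set} → (∀ {x y} → P x → P y → x ≡ y) →
                                     {xs : List (Fin n)} → Unique xs → All (λ x → x ∈ S ⊎ P x) xs →
                                     length xs ≤ suc ∣ S ∣
uniqueIn∪subsingleton⇒length≤1+∣∣ S P-sub {[]}     []                []                   = z≤n
uniqueIn∪subsingleton⇒length≤1+∣∣ S {P} P-sub {x ∷ xs} (x≢xs ∷ uniqueXs) (inj₁ x∈S ∷ xs⊆S∪P) =
  ℕ.≤-trans (s≤s (uniqueIn∪subsingleton⇒length≤1+∣∣ (S - x) P-sub uniqueXs (All.zipWith removeHead (x≢xs , xs⊆S∪P))))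
            (s≤s (x∈p⇒∣p-x∣<∣p∣ x∈S))
  where removeHead : ∀ {y} → x ≢ y × (y ∈ S ⊎ P y) → y ∈ S - x ⊎ P y
        removeHead (x≢y , inj₁ y∈S) = inj₁ (x∈p∧x≢y⇒x∈p-y y∈S (λ y≡x → x≢y (sym y≡x)))
        removeHead (x≢y , inj₂ Py)  = inj₂ Py
uniqueIn∪subsingleton⇒length≤1+∣∣ S {P} P-sub {x ∷ xs} (x≢xs ∷ uniqueXs) (inj₂ Px ∷ xs⊆S∪P) =
  s≤s (uniqueIn⇒length≤∣∣ S uniqueXs (All.zipWith inS (x≢xs , xs⊆S∪P)))
  where inS : ∀ {y} → x ≢ y × (y ∈ S ⊎ P y) → y ∈ S
        inS (x≢y , inj₁ y∈S) = y∈S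
        inS (x≢y , inj₂ Py)  = ⊥-elim (x≢y (P-sub Px Py))

countColour≤1⇒∉ : (c : Fin r) (cs : List (Fin r)) → countColour c (c ∷ cs) ≤ 1 → c ∉ₗ cs
countColour≤1⇒∉ c cs once c∈cs =
  ℕ.<⇒≱ (s≤s (countColour-∈ c∈cs)) (subst (_≤ 1) (countColour-∷ c cs) once)

countColour-map≤1⇒subsingleton : (f : Fin n → Fin m) {c : Fin m} (xs : List (Fin n)) →
                                  countColour c (map f xs) ≤ 1 →
                                  {x y : Fin n} → x ∈ₗ xs → y ∈ₗ xs → f x ≡ c → f y ≡ c → x ≡ y
countColour-map≤1⇒subsingleton f (z ∷ xs) once (here refl) (here refl) _    _  = refl
countColour-map≤1⇒subsingleton f (z ∷ xs) once (here refl) (there y∈) refl fy =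
  ⊥-elim (countColour≤1⇒∉ (f z) (map f xs) once (subst (_∈ₗ map f xs) fy (∈-map⁺ f y∈)))
countColour-map≤1⇒subsingleton f (z ∷ xs) once (there x∈) (here refl) fx refl =
  ⊥-elim (countColour≤1⇒∉ (f z) (map f xs) once (subst (_∈ₗ map f xs) fx (∈-map⁺ f x∈)))
countColour-map≤1⇒subsingleton f (z ∷ xs) once (there x∈) (there y∈) fx fy =
  countColour-map≤1⇒subsingleton f xs (ℕ.≤-trans (countColour-∷-≤ _ (f z) (map f xs)) once) x∈ y∈ fx fy

AtMostTwice⇒countColour≤1 : (xs : List (Fin m)) (c : Fin m) (ys : List (Fin m)) →
                            AtMostTwice (xs ++ c ∷ ys) → countColour c xs ≤ 1
AtMostTwice⇒countColour≤1 xs c ys μ = ℕ.≤-pred (begin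
  suc (countColour c xs)                  ≤⟨ s≤s (ℕ.m≤m+n _ _) ⟩
  suc (countColour c xs + countColour c ys) ≡⟨ cong suc (sym (countColour-++ c xs ys)) ⟩
  suc (countColour c (xs ++ ys))          ≡⟨ sym (countColour-∷ c (xs ++ ys)) ⟩
  countColour c (c ∷ xs ++ ys)            ≡⟨ countColour-↭ c (↭-sym (shift c xs ys)) ⟩
  countColour c (xs ++ c ∷ ys)            ≤⟨ μ c ⟩
  2                                       ∎)
  where open ℕ.≤-Reasoning

-- The diagonal colours matter here: a walk may stay inside a class.
record WalkDesign (r m : ℕ) : Set where
  field
    colouring        : EdgeColouring m r
    walk             : Fin m → Fin m → List (Fin m)
    walk-rainbow     : ∀ a b → Rainbow (edgeColours colouring a (walk a b ∷ʳ b))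
    walk-atMostTwice : ∀ a b → AtMostTwice (a ∷ b ∷ walk a b)

record ClassMap (n m k : ℕ) : Set where
  field
    class            : Fin n → Fin m
    member           : Fin m → Fin (suc k) → Fin n
    class-member     : ∀ c j → class (member c j) ≡ c
    member-injective : ∀ c {i j} → member c i ≡ member c j → i ≡ j

residue : .{{_ : NonZero m}} → Fin n → Fin m
residue {m = m} x = toℕ x mod m

residueClassMap : {k : ℕ} .{{_ : NonZero m}} → m * suc k ≤ n → ClassMap n m k
residueClassMap {m = m} {n = n} {k = k} bound = record
  { class            = residue
  ; member           = member
  ; class-member     = class-member
  ; member-injective = member-injective
  }
  where
  member-bound : (c : Fin m) (j : Fin (suc k)) → toℕ c + m * toℕ j < n
  member-bound c j = begin-strict
    toℕ c + m * toℕ j <⟨ ℕ.+-monoˡ-< (m * toℕ j) (toℕ<n c) ⟩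
    m + m * toℕ j     ≤⟨ ℕ.+-monoʳ-≤ m (ℕ.*-monoʳ-≤ m (ℕ.≤-pred (toℕ<n j))) ⟩
    m + m * k         ≡⟨ ℕ.*-suc m k ⟨
    m * suc k         ≤⟨ bound ⟩
    n                 ∎
    where open ℕ.≤-Reasoning

  member : Fin m → Fin (suc k) → Fin n
  member c j = fromℕ< (member-bound c j)

  toℕ-member : ∀ c j → toℕ (member c j) ≡ toℕ c + m * toℕ j
  toℕ-member c j = toℕ-fromℕ< (member-bound c j)

  class-member : ∀ c j → residue (member c j) ≡ c
  class-member c j = toℕ-injective (begin
    toℕ (residue (member c j))     ≡⟨ toℕ-fromℕ< _ ⟩
    toℕ (member c j) % m           ≡⟨ cong (_% m) (toℕ-member c j) ⟩
    (toℕ c + m * toℕ j) % m        ≡⟨ cong (λ t → (toℕ c + t) % m) (ℕ.*-comm m (toℕ j)) ⟩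
    (toℕ c + toℕ j * m) % m        ≡⟨ [m+kn]%n≡m%n (toℕ c) (toℕ j) m ⟩
    toℕ c % m                      ≡⟨ m<n⇒m%n≡m (toℕ<n c) ⟩
    toℕ c                          ∎)
    where open ≡-Reasoning

  member-injective : ∀ c {i j} → member c i ≡ member c j → i ≡ j
  member-injective c {i} {j} eq = toℕ-injective (ℕ.*-cancelˡ-≡ (toℕ i) (toℕ j) m
    (ℕ.+-cancelˡ-≡ (toℕ c) _ _ (trans (sym (toℕ-member c i)) (trans (cong toℕ eq) (toℕ-member c j)))))

module _ {k : ℕ} (C : ClassMap n m k) where
  open ClassMap C

  freshMember : (S : Subset n) → ∣ S ∣ < k → (c : Fin m) (F : List (Fin n)) → countColour c (map class F) ≤ 1 →
                ∃[ x ] class x ≡ c × x ∉ S × x ∉ₗ F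
  freshMember S ∣S∣<k c F once with any? (λ j → ¬? (member c j ∈? S) ×-dec ¬? (member c j ∈ₗ? F))
  ... | yes (j , ∉S , ∉F) = member c j , class-member c j , ∉S , ∉F
  ... | no none = ⊥-elim (ℕ.<⇒≱ ∣S∣<k (ℕ.≤-pred (subst (_≤ suc ∣ S ∣) (length-tabulate (member c)) members≤)))
    where
    used : ∀ j → member c j ∈ S ⊎ (member c j ∈ₗ F × class (member c j) ≡ c)
    used j with member c j ∈? S | member c j ∈ₗ? F
    ... | yes ∈S | _      = inj₁ ∈S
    ... | no ∉S  | yes ∈F = inj₂ (∈F , class-member c j)
    ... | no ∉S  | no ∉F  = ⊥-elim (none (j , ∉S , ∉F))

    members≤ : length (tabulate (member c)) ≤ suc ∣ S ∣
    members≤ = uniqueIn∪subsingleton⇒length≤1+∣∣ S {λ x → x ∈ₗ F × class x ≡ c}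
      (λ (x∈F , cx) (y∈F , cy) → countColour-map≤1⇒subsingleton class F once x∈F y∈F cx cy)
      (Unique.tabulate⁺ (member-injective c)) (tabulate⁺ used)

  liftWalk : (S : Subset n) → ∣ S ∣ < k → (cs : List (Fin m)) (F : List (Fin n)) →
             AtMostTwice (map class F ++ cs) → Unique F → All (_∉ S) F →
             ∃[ ps ] map class ps ≡ cs × Unique (ps ++ F) × All (_∉ S) (ps ++ F)
  liftWalk S ∣S∣<k []       F μ uniqueF F∉S = [] , refl , uniqueF , F∉S
  liftWalk S ∣S∣<k (c ∷ cs) F μ uniqueF F∉S
    with x , refl , x∉S , x∉F ← freshMember S ∣S∣<k c F (AtMostTwice⇒countColour≤1 (map class F) c cs μ)
    with ps , refl , unique , ∉S ← liftWalk S ∣S∣<k cs (x ∷ F) (AtMostTwice-↭ (shift (class x) (map class F) cs) μ)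
                                            (¬Any⇒All¬ F x∉F ∷ uniqueF) (x∉S ∷ F∉S)
    = x ∷ ps , refl , Unique-resp-↭ (shift x ps F) unique , All-resp-↭ (shift x ps F) ∉S

blowUp : {k : ℕ} → WalkDesign r m → ClassMap n m k → CompleteIsCanceling n r k
blowUp {r = r} {k = k} D C = pullback colouring class , canceling
  where
  open WalkDesign D
  open ClassMap C

  canceling : IsCancelingColouring k (pullback colouring class)
  canceling u v S u∉S v∉S ∣S∣<k with u ≟ v
  ... | yes refl = [] , [] ∷ [] , refl , u∉S ∷ [] , λ _ _ → refl
  ... | no u≢v
    with ps , classes , unique , ∉S ← liftWalk C S ∣S∣<k (walk (class u) (class v)) (u ∷ v ∷ [])
                                         (walk-atMostTwice (class u) (class v))
                                         ((u≢v ∷ []) ∷ [] ∷ []) (u∉S ∷ v∉S ∷ [])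
    = ps ∷ʳ v , Unique-resp-↭ (shift u ps [ v ]) unique , endpoint-∷ʳ u ps v ,
      All-resp-↭ (shift u ps [ v ]) ∉S ,
      subst Canceling (sym colours) (Rainbow⇒Canceling {cs = walkColours} (walk-rainbow (class u) (class v)))
    where
    walkColours : List (Fin r)
    walkColours = edgeColours colouring (class u) (walk (class u) (class v) ∷ʳ class v)

    colours : edgeColours (pullback colouring class) u (ps ∷ʳ v) ≡ walkColours
    colours = begin
      edgeColours (pullback colouring class) u (ps ∷ʳ v)
        ≡⟨ edgeColours-pullback colouring class u (ps ∷ʳ v) ⟩
      edgeColours colouring (class u) (map class (ps ∷ʳ v))
        ≡⟨ cong (edgeColours colouring (class u)) (map-++ class ps [ v ]) ⟩
      edgeColours colouring (class u) (map class ps ∷ʳ class v)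
        ≡⟨ cong (λ w → edgeColours colouring (class u) (w ∷ʳ class v)) classes ⟩
      walkColours ∎
      where open ≡-Reasoning

OneEndAt : Fin m → Fin m → Fin m → Set
OneEndAt z x y = (x ≡ z × y ≢ z) ⊎ (x ≢ z × y ≡ z)

∷ʳ-head : {A : Set} (xs : List A) (b : A) → ∃[ rest ] xs ∷ʳ b ≡ fromMaybe b (head xs) ∷ rest
∷ʳ-head []       b = [] , refl
∷ʳ-head (x ∷ xs) b = xs ∷ʳ b , refl

-- fromMaybe b (head (back a b)) is the first vertex of back a b ∷ʳ b, the one following the cut.
record SplitWalkDesign (r m : ℕ) : Set where
  field
    design     : WalkDesign r m
    hub        : Fin m
    front back : Fin m → Fin m → List (Fin m)
  open WalkDesign design
  field
    walk-split   : ∀ a b → walk a b ≡ front a b ++ back a b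
    split-at-hub : ∀ a b → OneEndAt hub (endpoint a (front a b)) (fromMaybe b (head (back a b)))
    hub-walk≢[]  : walk hub hub ≢ []

module Twin (D : SplitWalkDesign r m) where
  open SplitWalkDesign D
  open WalkDesign design renaming (colouring to χ)

  hubColour : Fin m → Fin (suc r)
  hubColour b with b ≟ hub
  ... | yes _ = zero
  ... | no _  = suc (colour χ hub b)

  hubColour-hub : hubColour hub ≡ zero
  hubColour-hub with hub ≟ hub
  ... | yes _    = refl
  ... | no hub≢hub = ⊥-elim (hub≢hub refl)

  hubColour-other : ∀ b → b ≢ hub → hubColour b ≡ suc (colour χ hub b)
  hubColour-other b b≢hub with b ≟ hub
  ... | yes b≡hub = ⊥-elim (b≢hub b≡hub)
  ... | no _      = refl

  hubColour-pair : ∀ {x y} → OneEndAt hub x y → (cs : List (Fin (suc r))) →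
                   hubColour x ∷ hubColour y ∷ cs ↭ zero ∷ suc (colour χ x y) ∷ cs
  hubColour-pair (inj₁ (refl , y≢hub)) cs rewrite hubColour-hub | hubColour-other _ y≢hub = ↭-refl
  hubColour-pair {x} (inj₂ (x≢hub , refl)) cs
    rewrite hubColour-hub | hubColour-other _ x≢hub | symmetric χ hub x = ↭-swap _ _ ↭-refl

  twinColour : Fin (suc m) → Fin (suc m) → Fin (suc r)
  twinColour zero    zero    = zero
  twinColour zero    (suc b) = hubColour b
  twinColour (suc a) zero    = hubColour a
  twinColour (suc a) (suc b) = suc (colour χ a b)

  χ′ : EdgeColouring (suc m) (suc r)
  χ′ = record { colour = twinColour ; symmetric = twinColour-symmetric }
    where
    twinColour-symmetric : ∀ a b → twinColour a b ≡ twinColour b a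
    twinColour-symmetric zero    zero    = refl
    twinColour-symmetric zero    (suc b) = refl
    twinColour-symmetric (suc a) zero    = refl
    twinColour-symmetric (suc a) (suc b) = cong suc (symmetric χ a b)

  edgeColours-map-suc : ∀ x ys → edgeColours χ′ (suc x) (map suc ys) ≡ map suc (edgeColours χ x ys)
  edgeColours-map-suc x []       = refl
  edgeColours-map-suc x (y ∷ ys) = cong (suc (colour χ x y) ∷_) (edgeColours-map-suc y ys)

  edgeColours-map-suc-∷ʳ : ∀ x ys z → edgeColours χ′ (suc x) (map suc ys ∷ʳ z) ≡
                                       map suc (edgeColours χ x ys) ∷ʳ twinColour (suc (endpoint x ys)) z
  edgeColours-map-suc-∷ʳ x ys z = begin
    edgeColours χ′ (suc x) (map suc ys ∷ʳ z)
      ≡⟨ edgeColours-++ χ′ (suc x) (map suc ys) [ z ] ⟩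
    edgeColours χ′ (suc x) (map suc ys) ∷ʳ twinColour (endpoint (suc x) (map suc ys)) z
      ≡⟨ cong₂ (λ cs w → cs ∷ʳ twinColour w z) (edgeColours-map-suc x ys) (endpoint-map suc x ys) ⟩
    map suc (edgeColours χ x ys) ∷ʳ twinColour (suc (endpoint x ys)) z ∎
    where open ≡-Reasoning

  twinWalk : Fin (suc m) → Fin (suc m) → List (Fin (suc m))
  twinWalk zero    zero    = suc hub ∷ map suc (walk hub hub)
  twinWalk zero    (suc b) = suc hub ∷ map suc (walk hub b)
  twinWalk (suc a) zero    = map suc (walk a hub) ∷ʳ suc hub
  twinWalk (suc a) (suc b) = map suc (front a b) ++ zero ∷ map suc (back a b)

  untwin : Fin (suc m) → Fin m
  untwin zero    = hub
  untwin (suc a) = a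

  hub∉hub-walk : hub ∉ₗ walk hub hub
  hub∉hub-walk = countColour≤1⇒∉ hub (walk hub hub)
    (ℕ.≤-pred (subst (_≤ 2) (countColour-∷ hub (hub ∷ walk hub hub)) (walk-atMostTwice hub hub hub)))

  hub-walk-end≢hub : endpoint hub (walk hub hub) ≢ hub
  hub-walk-end≢hub with walk hub hub | hub-walk≢[] | hub∉hub-walk
  ... | []     | nonempty | _   = ⊥-elim (nonempty refl)
  ... | y ∷ ys | _        | hub∉ = λ end≡hub → hub∉ (subst (_∈ₗ y ∷ ys) end≡hub (endpoint-∈ hub y ys))

  twinWalk-colours : ∀ a b → edgeColours χ′ a (twinWalk a b ∷ʳ b) ↭
                             zero ∷ map suc (edgeColours χ (untwin a) (walk (untwin a) (untwin b) ∷ʳ untwin b))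
  twinWalk-colours zero zero = ↭-reflexive (begin
    hubColour hub ∷ edgeColours χ′ (suc hub) (map suc W ∷ʳ zero)
      ≡⟨ cong₂ _∷_ hubColour-hub (edgeColours-map-suc-∷ʳ hub W zero) ⟩
    zero ∷ map suc (edgeColours χ hub W) ∷ʳ hubColour e
      ≡⟨ cong (λ c → zero ∷ map suc (edgeColours χ hub W) ∷ʳ c)
              (trans (hubColour-other e hub-walk-end≢hub) (cong suc (symmetric χ hub e))) ⟩
    zero ∷ map suc (edgeColours χ hub W) ∷ʳ suc (colour χ e hub)
      ≡⟨ cong (zero ∷_) (sym (map-++ suc (edgeColours χ hub W) [ colour χ e hub ])) ⟩
    zero ∷ map suc (edgeColours χ hub W ∷ʳ colour χ e hub)
      ≡⟨ cong (λ cs → zero ∷ map suc cs) (sym (edgeColours-++ χ hub W [ hub ])) ⟩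
    zero ∷ map suc (edgeColours χ hub (W ∷ʳ hub)) ∎)
    where
    open ≡-Reasoning
    W : List (Fin m)
    W = walk hub hub
    e : Fin m
    e = endpoint hub W
  twinWalk-colours zero (suc b) = ↭-reflexive (cong₂ _∷_ hubColour-hub (begin
    edgeColours χ′ (suc hub) (map suc (walk hub b) ∷ʳ suc b)
      ≡⟨ cong (edgeColours χ′ (suc hub)) (sym (map-++ suc (walk hub b) [ b ])) ⟩
    edgeColours χ′ (suc hub) (map suc (walk hub b ∷ʳ b))
      ≡⟨ edgeColours-map-suc hub (walk hub b ∷ʳ b) ⟩
    map suc (edgeColours χ hub (walk hub b ∷ʳ b)) ∎))
    where open ≡-Reasoning
  twinWalk-colours (suc a) zero = begin
    edgeColours χ′ (suc a) ((map suc W ∷ʳ suc hub) ∷ʳ zero)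
      ≡⟨ cong (λ ws → edgeColours χ′ (suc a) (ws ∷ʳ zero)) (sym (map-++ suc W [ hub ])) ⟩
    edgeColours χ′ (suc a) (map suc (W ∷ʳ hub) ∷ʳ zero)
      ≡⟨ edgeColours-map-suc-∷ʳ a (W ∷ʳ hub) zero ⟩
    map suc (edgeColours χ a (W ∷ʳ hub)) ∷ʳ hubColour (endpoint a (W ∷ʳ hub))
      ≡⟨ cong (λ c → map suc (edgeColours χ a (W ∷ʳ hub)) ∷ʳ c)
              (trans (cong hubColour (endpoint-∷ʳ a W hub)) hubColour-hub) ⟩
    map suc (edgeColours χ a (W ∷ʳ hub)) ∷ʳ zero
      ↭⟨ ↭-sym (∷↭∷ʳ zero _) ⟩
    zero ∷ map suc (edgeColours χ a (W ∷ʳ hub)) ∎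
    where
    open PermutationReasoning
    W : List (Fin m)
    W = walk a hub
  twinWalk-colours (suc a) (suc b) with rest , back≡ ← ∷ʳ-head (back a b) b = begin
    edgeColours χ′ (suc a) ((map suc F ++ zero ∷ map suc B) ∷ʳ suc b)
      ≡⟨ cong (edgeColours χ′ (suc a)) twinWalk≡ ⟩
    edgeColours χ′ (suc a) (map suc F ++ zero ∷ suc y ∷ map suc rest)
      ≡⟨ edgeColours-++ χ′ (suc a) (map suc F) _ ⟩
    edgeColours χ′ (suc a) (map suc F) ++
    edgeColours χ′ (endpoint (suc a) (map suc F)) (zero ∷ suc y ∷ map suc rest)
      ≡⟨ cong₂ (λ cs w → cs ++ twinColour w zero ∷ hubColour y ∷ edgeColours χ′ (suc y) (map suc rest))
               (edgeColours-map-suc a F) (endpoint-map suc a F) ⟩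
    map suc (edgeColours χ a F) ++ hubColour e ∷ hubColour y ∷ edgeColours χ′ (suc y) (map suc rest)
      ≡⟨ cong (λ cs → map suc (edgeColours χ a F) ++ hubColour e ∷ hubColour y ∷ cs)
              (edgeColours-map-suc y rest) ⟩
    map suc (edgeColours χ a F) ++ hubColour e ∷ hubColour y ∷ map suc (edgeColours χ y rest)
      ↭⟨ ++⁺ˡ (map suc (edgeColours χ a F)) (hubColour-pair (split-at-hub a b) _) ⟩
    map suc (edgeColours χ a F) ++ zero ∷ suc (colour χ e y) ∷ map suc (edgeColours χ y rest)
      ↭⟨ shift zero (map suc (edgeColours χ a F)) _ ⟩
    zero ∷ map suc (edgeColours χ a F) ++ map suc (colour χ e y ∷ edgeColours χ y rest)
      ≡⟨ cong (zero ∷_) (sym (map-++ suc (edgeColours χ a F) _)) ⟩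
    zero ∷ map suc (edgeColours χ a F ++ colour χ e y ∷ edgeColours χ y rest)
      ≡⟨ cong (λ cs → zero ∷ map suc cs) (sym walkColours≡) ⟩
    zero ∷ map suc (edgeColours χ a (walk a b ∷ʳ b)) ∎
    where
    open PermutationReasoning
    F B : List (Fin m)
    F = front a b
    B = back a b
    e y : Fin m
    e = endpoint a F
    y = fromMaybe b (head B)

    twinWalk≡ : (map suc F ++ zero ∷ map suc B) ∷ʳ suc b ≡ map suc F ++ zero ∷ suc y ∷ map suc rest
    twinWalk≡ = trans (++-assoc (map suc F) (zero ∷ map suc B) [ suc b ])
                      (cong (λ ws → map suc F ++ zero ∷ ws)
                            (trans (sym (map-++ suc B [ b ])) (cong (map suc) back≡)))

    walkColours≡ : edgeColours χ a (walk a b ∷ʳ b) ≡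
                   edgeColours χ a F ++ colour χ e y ∷ edgeColours χ y rest
    walkColours≡ = trans (cong (λ ws → edgeColours χ a (ws ∷ʳ b)) (walk-split a b))
                  (trans (cong (edgeColours χ a) (trans (++-assoc F B [ b ]) (cong (F ++_) back≡)))
                         (edgeColours-++ χ a F (y ∷ rest)))

  twinWalk-atMostTwice : ∀ a b → AtMostTwice (a ∷ b ∷ twinWalk a b)
  twinWalk-atMostTwice zero zero =
    AtMostTwice-zero∷zero∷map-suc {xs = hub ∷ walk hub hub}
                                  (AtMostTwice-∷⁻ {x = hub} (walk-atMostTwice hub hub))
  twinWalk-atMostTwice zero (suc b) =
    AtMostTwice-↭ (↭-prep zero (↭-swap (suc hub) (suc b) ↭-refl))
                  (AtMostTwice-zero∷map-suc {xs = hub ∷ b ∷ walk hub b} (walk-atMostTwice hub b))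
  twinWalk-atMostTwice (suc a) zero =
    AtMostTwice-↭ (↭-sym (↭-swap (suc a) zero (↭-sym (∷↭∷ʳ (suc hub) (map suc (walk a hub))))))
                  (AtMostTwice-zero∷map-suc {xs = a ∷ hub ∷ walk a hub} (walk-atMostTwice a hub))
  twinWalk-atMostTwice (suc a) (suc b) =
    AtMostTwice-↭ (↭-sym (shift zero (suc a ∷ suc b ∷ map suc (front a b)) (map suc (back a b))))
                  (subst (λ ws → AtMostTwice (zero ∷ suc a ∷ suc b ∷ ws)) (map-++ suc (front a b) (back a b))
                         (AtMostTwice-zero∷map-suc {xs = a ∷ b ∷ front a b ++ back a b}
                           (subst (λ ws → AtMostTwice (a ∷ b ∷ ws)) (walk-split a b) (walk-atMostTwice a b))))

  twinDesign : WalkDesign (suc r) (suc m)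
  twinDesign = record
    { colouring        = χ′
    ; walk             = twinWalk
    ; walk-rainbow     = λ a b → Rainbow-↭ (↭-sym (twinWalk-colours a b))
                                             (Rainbow-zero∷map-suc (walk-rainbow (untwin a) (untwin b)))
    ; walk-atMostTwice = twinWalk-atMostTwice
    }

  twinFront twinBack : Fin (suc m) → Fin (suc m) → List (Fin (suc m))
  twinFront zero    _       = []
  twinFront (suc a) zero    = twinWalk (suc a) zero
  twinFront (suc a) (suc b) with split-at-hub a b
  ... | inj₁ _ = map suc (front a b)
  ... | inj₂ _ = map suc (front a b) ∷ʳ zero
  twinBack zero    b       = twinWalk zero b
  twinBack (suc a) zero    = []
  twinBack (suc a) (suc b) with split-at-hub a b
  ... | inj₁ _ = zero ∷ map suc (back a b)
  ... | inj₂ _ = map suc (back a b)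

  twinWalk-split : ∀ a b → twinWalk a b ≡ twinFront a b ++ twinBack a b
  twinWalk-split zero    zero    = refl
  twinWalk-split zero    (suc b) = refl
  twinWalk-split (suc a) zero    = sym (++-identityʳ _)
  twinWalk-split (suc a) (suc b) with split-at-hub a b
  ... | inj₁ _ = refl
  ... | inj₂ _ = sym (++-assoc (map suc (front a b)) [ zero ] (map suc (back a b)))

  fromMaybe-head-map-suc : (xs : List (Fin m)) (b : Fin m) →
                           fromMaybe {A = Fin (suc m)} (suc b) (head (map suc xs)) ≡ suc (fromMaybe b (head xs))
  fromMaybe-head-map-suc []       b = refl
  fromMaybe-head-map-suc (x ∷ xs) b = refl

  twinSplit-at-hub : ∀ a b → OneEndAt (suc hub) (endpoint a (twinFront a b)) (fromMaybe b (head (twinBack a b)))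
  twinSplit-at-hub zero    zero    = inj₂ (0≢1+n , refl)
  twinSplit-at-hub zero    (suc b) = inj₂ (0≢1+n , refl)
  twinSplit-at-hub (suc a) zero    = inj₁ (endpoint-∷ʳ (suc a) (map suc (walk a hub)) (suc hub) , 0≢1+n)
  twinSplit-at-hub (suc a) (suc b) with split-at-hub a b
  ... | inj₁ (e≡hub , _) = inj₁ (trans (endpoint-map suc a (front a b)) (cong suc e≡hub) , 0≢1+n)
  ... | inj₂ (_ , y≡hub) =
    inj₂ (subst (_≢ suc hub) (sym (endpoint-∷ʳ (suc a) (map suc (front a b)) zero)) 0≢1+n ,
          trans (fromMaybe-head-map-suc (back a b) b) (cong suc y≡hub))

  twinSplitDesign : SplitWalkDesign (suc r) (suc m)
  twinSplitDesign = record
    { design       = twinDesign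
    ; hub          = suc hub
    ; front        = twinFront
    ; back         = twinBack
    ; walk-split   = twinWalk-split
    ; split-at-hub = twinSplit-at-hub
    ; hub-walk≢[]  = λ twinWalk≡[] → case ++-conicalʳ (map suc (front hub hub)) _ twinWalk≡[] of λ ()
    }

twin : SplitWalkDesign r m → SplitWalkDesign (suc r) (suc m)
twin D = Twin.twinSplitDesign D

oneEndAt? : (z x y : Fin m) → Dec (OneEndAt z x y)
oneEndAt? z x y = ((x ≟ z) ×-dec ¬? (y ≟ z)) ⊎-dec (¬? (x ≟ z) ×-dec (y ≟ z))

rainbow? : (cs : List (Fin r)) → Dec (Rainbow cs)
rainbow? cs = all? λ i → countColour i cs ℕ.≟ 1

atMostTwice? : (xs : List (Fin m)) → Dec (AtMostTwice xs)
atMostTwice? xs = all? λ c → countColour c xs ≤? 2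

module ColourTable (r : ℕ) .{{_ : NonZero r}} (table : Vec (Vec ℕ m) m) where
  colourOf : Fin m → Fin m → Fin r
  colourOf a b = lookup (lookup table a) b mod r

  Symmetric : Set
  Symmetric = ∀ a b → colourOf a b ≡ colourOf b a

  symmetric? : Dec Symmetric
  symmetric? = all? λ a → all? λ b → colourOf a b ≟ colourOf b a

  tableColouring : Symmetric → EdgeColouring m r
  tableColouring sym = record { colour = colourOf ; symmetric = sym }

module TabulatedSplitDesign (r m : ℕ) .{{_ : NonZero r}} .{{_ : NonZero m}}
                            (colourTable : Vec (Vec ℕ m) m) (frontTable backTable : Vec (Vec (List ℕ) m) m)
                            (hub : Fin m) where
  open ColourTable r colourTable public

  front back walk : Fin m → Fin m → List (Fin m)
  front a b = map (_mod m) (lookup (lookup frontTable a) b)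
  back  a b = map (_mod m) (lookup (lookup backTable a) b)
  walk  a b = front a b ++ back a b

  module _ (sym : Symmetric) where
    Valid : Set
    Valid = (∀ a b → Rainbow (edgeColours (tableColouring sym) a (walk a b ∷ʳ b))) ×
            (∀ a b → AtMostTwice (a ∷ b ∷ walk a b)) ×
            (∀ a b → OneEndAt hub (endpoint a (front a b)) (fromMaybe b (head (back a b)))) ×
            walk hub hub ≢ []

    valid? : Dec Valid
    valid? = (all? λ a → all? λ b → rainbow? (edgeColours (tableColouring sym) a (walk a b ∷ʳ b))) ×-dec
             (all? λ a → all? λ b → atMostTwice? (a ∷ b ∷ walk a b)) ×-dec
             (all? λ a → all? λ b → oneEndAt? hub (endpoint a (front a b)) (fromMaybe b (head (back a b)))) ×-dec
             ¬? (≡-dec _≟_ (walk hub hub) [])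

    splitDesign : Valid → SplitWalkDesign r m
    splitDesign (rainbow , atMostTwice , split , nonempty) = record
      { design       = record { colouring = tableColouring sym ; walk = walk
                              ; walk-rainbow = rainbow ; walk-atMostTwice = atMostTwice }
      ; hub          = hub
      ; front        = front
      ; back         = back
      ; walk-split   = λ _ _ → refl
      ; split-at-hub = split
      ; hub-walk≢[]  = nonempty
      }

module Design₃ = TabulatedSplitDesign 3 3
  ((2 ∷ 1 ∷ 0 ∷ []) ∷
   (1 ∷ 1 ∷ 2 ∷ []) ∷
   (0 ∷ 2 ∷ 1 ∷ []) ∷ [])
  (([]          ∷ []          ∷ (0 ∷ []) ∷ []) ∷
   ((1 ∷ 2 ∷ []) ∷ []          ∷ []       ∷ []) ∷
   ((2 ∷ [])     ∷ []          ∷ []       ∷ []) ∷ [])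
  (((1 ∷ 2 ∷ []) ∷ (2 ∷ 1 ∷ []) ∷ (2 ∷ [])     ∷ []) ∷
   ([]           ∷ (0 ∷ 2 ∷ []) ∷ (0 ∷ 0 ∷ []) ∷ []) ∷
   ((0 ∷ [])     ∷ (0 ∷ 0 ∷ []) ∷ (0 ∷ 1 ∷ []) ∷ []) ∷ [])
  zero

design₃ : SplitWalkDesign 3 3
design₃ = Design₃.splitDesign colours-symmetric (from-yes (Design₃.valid? colours-symmetric))
  where colours-symmetric : Design₃.Symmetric
        colours-symmetric = from-yes Design₃.symmetric?

module Design₅ = TabulatedSplitDesign 5 4
  ((3 ∷ 4 ∷ 0 ∷ 2 ∷ []) ∷
   (4 ∷ 0 ∷ 3 ∷ 2 ∷ []) ∷
   (0 ∷ 3 ∷ 4 ∷ 1 ∷ []) ∷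
   (2 ∷ 2 ∷ 1 ∷ 1 ∷ []) ∷ [])
  (([]                    ∷ (0 ∷ []) ∷ (0 ∷ []) ∷ (0 ∷ []) ∷ []) ∷
   ((1 ∷ 2 ∷ 2 ∷ 3 ∷ [])  ∷ []       ∷ []       ∷ []       ∷ []) ∷
   ([]                    ∷ []       ∷ []       ∷ []       ∷ []) ∷
   ((3 ∷ [])              ∷ (3 ∷ []) ∷ (3 ∷ []) ∷ []       ∷ []) ∷ [])
  (((1 ∷ 1 ∷ 2 ∷ 3 ∷ []) ∷ (2 ∷ 2 ∷ 3 ∷ [])     ∷ (1 ∷ 1 ∷ 3 ∷ [])     ∷ (1 ∷ 1 ∷ 3 ∷ [])     ∷ []) ∷
   ([]                   ∷ (0 ∷ 0 ∷ 2 ∷ 3 ∷ []) ∷ (0 ∷ 2 ∷ 1 ∷ 3 ∷ []) ∷ (0 ∷ 2 ∷ 1 ∷ 3 ∷ []) ∷ []) ∷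
   ((0 ∷ 1 ∷ 2 ∷ 3 ∷ []) ∷ (0 ∷ 1 ∷ 2 ∷ 3 ∷ []) ∷ (0 ∷ 0 ∷ 1 ∷ 3 ∷ []) ∷ (0 ∷ 0 ∷ 1 ∷ 3 ∷ []) ∷ []) ∷
   ((0 ∷ 1 ∷ 2 ∷ [])     ∷ (0 ∷ 0 ∷ 1 ∷ [])     ∷ (0 ∷ 0 ∷ 2 ∷ [])     ∷ (0 ∷ 0 ∷ 2 ∷ 2 ∷ []) ∷ []) ∷ [])
  zero

design₅ : SplitWalkDesign 5 4
design₅ = Design₅.splitDesign colours-symmetric (from-yes (Design₅.valid? colours-symmetric))
  where colours-symmetric : Design₅.Symmetric
        colours-symmetric = from-yes Design₅.symmetric?

design₄ : SplitWalkDesign 4 4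
design₄ = twin design₃

design₅₊ : ∀ t → SplitWalkDesign (5 + t) (4 + t)
design₅₊ zero    = design₅
design₅₊ (suc t) = twin (design₅₊ t)

CancelingPath : EdgeColouring n r → Fin n → Fin n → List (Fin n) → Set
CancelingPath χ u v rest = Unique (u ∷ rest) × endpoint u rest ≡ v × Canceling (edgeColours χ u rest)

cancelingPath⇒avoiding : {χ : EdgeColouring n r} {u v : Fin n} {S : Subset n} {rest : List (Fin n)} →
                         CancelingPath χ u v rest → u ∉ S → ¬ Any (_∈ S) rest → CancelingPathAvoiding χ S u v
cancelingPath⇒avoiding {rest = rest} (unique , end , canceling) u∉S rest∩S≡∅ =
  rest , unique , end , u∉S ∷ ¬Any⇒All¬ rest rest∩S≡∅ , canceling

-- Taking w = u shows that ps contains a canceling path at all.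
SurvivesOneDeletion : EdgeColouring n r → Fin n → Fin n → List (List (Fin n)) → Set
SurvivesOneDeletion χ u v ps = ∀ w → Any (λ p → CancelingPath χ u v p × (w ≢ u → w ≢ v → w ∉ₗ p)) ps

survivesOneDeletion? : (χ : EdgeColouring n r) (u v : Fin n) (ps : List (List (Fin n))) →
                       Dec (SurvivesOneDeletion χ u v ps)
survivesOneDeletion? χ u v ps =
  all? λ w → Any.any? (λ p → cancelingPath? p ×-dec (¬? (w ≟ u) →-dec ¬? (w ≟ v) →-dec ¬? (w ∈ₗ? p))) ps
  where
  cancelingPath? : ∀ p → Dec (CancelingPath χ u v p)
  cancelingPath? p = allPairs? (λ x y → ¬? (x ≟ y)) (u ∷ p) ×-dec endpoint u p ≟ v ×-dec
                     (all? λ i → all? λ j → countColour i (edgeColours χ u p) ℕ.≟ countColour j (edgeColours χ u p))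

-- A listed path meeting S at x can be traded for one avoiding x; if that one meets S as well, ∣ S ∣ ≥ 2.
survivesOneDeletion⇒2-canceling : (χ : EdgeColouring n r) (paths : Fin n → Fin n → List (List (Fin n))) →
                                   (∀ u v → u ≡ v ⊎ SurvivesOneDeletion χ u v (paths u v)) → IsCancelingColouring 2 χ
survivesOneDeletion⇒2-canceling χ paths survives u v S u∉S v∉S ∣S∣<2 with survives u v
... | inj₁ refl = [] , [] ∷ [] , refl , u∉S ∷ [] , λ _ _ → refl
... | inj₂ survivesUV
  with p , _ , path-p , _ ← find (survivesUV u)
  with Any.any? (_∈? S) p
... | no p∩S≡∅ = cancelingPath⇒avoiding path-p u∉S p∩S≡∅
... | yes p∩S≢∅
  with x , _ , x∈S ← find p∩S≢∅
  with q , _ , path-q , q-avoids ← find (survivesUV x)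
  with Any.any? (_∈? S) q
... | no q∩S≡∅ = cancelingPath⇒avoiding path-q u∉S q∩S≡∅
... | yes q∩S≢∅
  with y , y∈q , y∈S ← find q∩S≢∅ =
  ⊥-elim (ℕ.<⇒≱ ∣S∣<2 (uniqueIn⇒length≤∣∣ S ((x≢y ∷ []) ∷ [] ∷ []) (x∈S ∷ y∈S ∷ [])))
  where
  x∉q : x ∉ₗ q
  x∉q = q-avoids (λ x≡u → u∉S (subst (_∈ S) x≡u x∈S)) (λ x≡v → v∉S (subst (_∈ S) x≡v x∈S))
  x≢y : x ≢ y
  x≢y x≡y = x∉q (subst (_∈ₗ q) (sym x≡y) y∈q)

tablePaths : .{{_ : NonZero n}} → Vec (Vec (List (List ℕ)) n) n → Fin n → Fin n → List (List (Fin n))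
tablePaths {n = n} table u v = map (map (_mod n)) (lookup (lookup table u) v)

module PathTable (χ : EdgeColouring n r) .{{_ : NonZero n}} (table : Vec (Vec (List (List ℕ)) n) n) where
  Robust : Set
  Robust = ∀ u v → u ≡ v ⊎ SurvivesOneDeletion χ u v (tablePaths table u v)

  robust? : Dec Robust
  robust? = all? λ u → all? λ v → (u ≟ v) ⊎-dec survivesOneDeletion? χ u v (tablePaths table u v)

  canceling : Robust → CompleteIsCanceling n r 2
  canceling robust = χ , survivesOneDeletion⇒2-canceling χ (tablePaths table) robust

module Pattern₃ = ColourTable 3
  ((0 ∷ 1 ∷ 2 ∷ []) ∷
   (1 ∷ 2 ∷ 0 ∷ []) ∷
   (2 ∷ 0 ∷ 1 ∷ []) ∷ [])

module Pattern₄ = ColourTable 4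
  ((0 ∷ 1 ∷ 2 ∷ 3 ∷ []) ∷
   (1 ∷ 1 ∷ 3 ∷ 0 ∷ []) ∷
   (2 ∷ 3 ∷ 3 ∷ 1 ∷ []) ∷
   (3 ∷ 0 ∷ 1 ∷ 2 ∷ []) ∷ [])

pattern₃ : EdgeColouring 3 3
pattern₃ = Pattern₃.tableColouring (from-yes Pattern₃.symmetric?)

pattern₄ : EdgeColouring 4 4
pattern₄ = Pattern₄.tableColouring (from-yes Pattern₄.symmetric?)

residueColouring : .{{_ : NonZero m}} → EdgeColouring m r → EdgeColouring n r
residueColouring χ = pullback χ residue

paths₃,₆ : Vec (Vec (List (List ℕ)) 6) 6
paths₃,₆ =
  ([] ∷ ((2 ∷ 5 ∷ 1 ∷ []) ∷ (3 ∷ 4 ∷ 1 ∷ []) ∷ []) ∷ ((1 ∷ 4 ∷ 2 ∷ []) ∷ (3 ∷ 5 ∷ 2 ∷ []) ∷ []) ∷ ((1 ∷ 2 ∷ 3 ∷ []) ∷ (2 ∷ 4 ∷ 3 ∷ []) ∷ (1 ∷ 5 ∷ 3 ∷ []) ∷ []) ∷ ((2 ∷ 5 ∷ 4 ∷ []) ∷ (3 ∷ 1 ∷ 4 ∷ []) ∷ []) ∷ ((1 ∷ 4 ∷ 5 ∷ []) ∷ (3 ∷ 2 ∷ 5 ∷ []) ∷ []) ∷ []) ∷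
  (((2 ∷ 5 ∷ 0 ∷ []) ∷ (4 ∷ 3 ∷ 0 ∷ []) ∷ []) ∷ [] ∷ ((0 ∷ 3 ∷ 2 ∷ []) ∷ (4 ∷ 5 ∷ 2 ∷ []) ∷ []) ∷ ((2 ∷ 5 ∷ 3 ∷ []) ∷ (4 ∷ 0 ∷ 3 ∷ []) ∷ []) ∷ ((0 ∷ 2 ∷ 4 ∷ []) ∷ (2 ∷ 3 ∷ 4 ∷ []) ∷ (0 ∷ 5 ∷ 4 ∷ []) ∷ []) ∷ ((0 ∷ 3 ∷ 5 ∷ []) ∷ (4 ∷ 2 ∷ 5 ∷ []) ∷ []) ∷ []) ∷
  (((1 ∷ 4 ∷ 0 ∷ []) ∷ (5 ∷ 3 ∷ 0 ∷ []) ∷ []) ∷ ((0 ∷ 3 ∷ 1 ∷ []) ∷ (5 ∷ 4 ∷ 1 ∷ []) ∷ []) ∷ [] ∷ ((1 ∷ 4 ∷ 3 ∷ []) ∷ (5 ∷ 0 ∷ 3 ∷ []) ∷ []) ∷ ((0 ∷ 3 ∷ 4 ∷ []) ∷ (5 ∷ 1 ∷ 4 ∷ []) ∷ []) ∷ ((0 ∷ 1 ∷ 5 ∷ []) ∷ (1 ∷ 3 ∷ 5 ∷ []) ∷ (0 ∷ 4 ∷ 5 ∷ []) ∷ []) ∷ []) ∷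
  (((1 ∷ 2 ∷ 0 ∷ []) ∷ (2 ∷ 4 ∷ 0 ∷ []) ∷ (1 ∷ 5 ∷ 0 ∷ []) ∷ []) ∷ ((0 ∷ 4 ∷ 1 ∷ []) ∷ (2 ∷ 5 ∷ 1 ∷ []) ∷ []) ∷ ((0 ∷ 5 ∷ 2 ∷ []) ∷ (1 ∷ 4 ∷ 2 ∷ []) ∷ []) ∷ [] ∷ ((0 ∷ 1 ∷ 4 ∷ []) ∷ (2 ∷ 5 ∷ 4 ∷ []) ∷ []) ∷ ((0 ∷ 2 ∷ 5 ∷ []) ∷ (1 ∷ 4 ∷ 5 ∷ []) ∷ []) ∷ []) ∷
  (((1 ∷ 3 ∷ 0 ∷ []) ∷ (2 ∷ 5 ∷ 0 ∷ []) ∷ []) ∷ ((0 ∷ 2 ∷ 1 ∷ []) ∷ (2 ∷ 3 ∷ 1 ∷ []) ∷ (0 ∷ 5 ∷ 1 ∷ []) ∷ []) ∷ ((0 ∷ 3 ∷ 2 ∷ []) ∷ (1 ∷ 5 ∷ 2 ∷ []) ∷ []) ∷ ((1 ∷ 0 ∷ 3 ∷ []) ∷ (2 ∷ 5 ∷ 3 ∷ []) ∷ []) ∷ [] ∷ ((0 ∷ 3 ∷ 5 ∷ []) ∷ (1 ∷ 2 ∷ 5 ∷ []) ∷ []) ∷ []) ∷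
  (((1 ∷ 4 ∷ 0 ∷ []) ∷ (2 ∷ 3 ∷ 0 ∷ []) ∷ []) ∷ ((0 ∷ 3 ∷ 1 ∷ []) ∷ (2 ∷ 4 ∷ 1 ∷ []) ∷ []) ∷ ((0 ∷ 1 ∷ 2 ∷ []) ∷ (1 ∷ 3 ∷ 2 ∷ []) ∷ (0 ∷ 4 ∷ 2 ∷ []) ∷ []) ∷ ((1 ∷ 4 ∷ 3 ∷ []) ∷ (2 ∷ 0 ∷ 3 ∷ []) ∷ []) ∷ ((0 ∷ 3 ∷ 4 ∷ []) ∷ (2 ∷ 1 ∷ 4 ∷ []) ∷ []) ∷ [] ∷ []) ∷
  []

paths₃,₇ : Vec (Vec (List (List ℕ)) 7) 7
paths₃,₇ =
  ([] ∷ ((2 ∷ 5 ∷ 1 ∷ []) ∷ (3 ∷ 4 ∷ 1 ∷ []) ∷ []) ∷ ((1 ∷ 4 ∷ 2 ∷ []) ∷ (3 ∷ 5 ∷ 2 ∷ []) ∷ []) ∷ ((1 ∷ 2 ∷ 3 ∷ []) ∷ (2 ∷ 4 ∷ 3 ∷ []) ∷ (1 ∷ 5 ∷ 3 ∷ []) ∷ []) ∷ ((2 ∷ 5 ∷ 4 ∷ []) ∷ (3 ∷ 1 ∷ 4 ∷ []) ∷ []) ∷ ((1 ∷ 4 ∷ 5 ∷ []) ∷ (3 ∷ 2 ∷ 5 ∷ []) ∷ []) ∷ ((1 ∷ 2 ∷ 6 ∷ []) ∷ (2 ∷ 4 ∷ 6 ∷ []) ∷ (1 ∷ 5 ∷ 6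 ∷ []) ∷ []) ∷ []) ∷
  (((2 ∷ 5 ∷ 0 ∷ []) ∷ (4 ∷ 3 ∷ 0 ∷ []) ∷ []) ∷ [] ∷ ((0 ∷ 3 ∷ 2 ∷ []) ∷ (3 ∷ 6 ∷ 2 ∷ []) ∷ (0 ∷ 6 ∷ 2 ∷ []) ∷ []) ∷ ((2 ∷ 5 ∷ 3 ∷ []) ∷ (4 ∷ 0 ∷ 3 ∷ []) ∷ []) ∷ ((0 ∷ 2 ∷ 4 ∷ []) ∷ (2 ∷ 3 ∷ 4 ∷ []) ∷ (0 ∷ 5 ∷ 4 ∷ []) ∷ []) ∷ ((0 ∷ 3 ∷ 5 ∷ []) ∷ (3 ∷ 6 ∷ 5 ∷ []) ∷ (0 ∷ 6 ∷ 5 ∷ []) ∷ []) ∷ ((2 ∷ 5 ∷ 6 ∷ []) ∷ (4 ∷ 0 ∷ 6 ∷ []) ∷ []) ∷ []) ∷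
  (((1 ∷ 4 ∷ 0 ∷ []) ∷ (5 ∷ 3 ∷ 0 ∷ []) ∷ []) ∷ ((0 ∷ 3 ∷ 1 ∷ []) ∷ (3 ∷ 6 ∷ 1 ∷ []) ∷ (0 ∷ 6 ∷ 1 ∷ []) ∷ []) ∷ [] ∷ ((1 ∷ 4 ∷ 3 ∷ []) ∷ (5 ∷ 0 ∷ 3 ∷ []) ∷ []) ∷ ((0 ∷ 3 ∷ 4 ∷ []) ∷ (3 ∷ 6 ∷ 4 ∷ []) ∷ (0 ∷ 6 ∷ 4 ∷ []) ∷ []) ∷ ((0 ∷ 1 ∷ 5 ∷ []) ∷ (1 ∷ 3 ∷ 5 ∷ []) ∷ (0 ∷ 4 ∷ 5 ∷ []) ∷ []) ∷ ((1 ∷ 4 ∷ 6 ∷ []) ∷ (5 ∷ 0 ∷ 6 ∷ []) ∷ []) ∷ []) ∷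
  (((1 ∷ 2 ∷ 0 ∷ []) ∷ (2 ∷ 4 ∷ 0 ∷ []) ∷ (1 ∷ 5 ∷ 0 ∷ []) ∷ []) ∷ ((0 ∷ 4 ∷ 1 ∷ []) ∷ (2 ∷ 5 ∷ 1 ∷ []) ∷ []) ∷ ((0 ∷ 5 ∷ 2 ∷ []) ∷ (1 ∷ 4 ∷ 2 ∷ []) ∷ []) ∷ [] ∷ ((0 ∷ 1 ∷ 4 ∷ []) ∷ (2 ∷ 5 ∷ 4 ∷ []) ∷ []) ∷ ((0 ∷ 2 ∷ 5 ∷ []) ∷ (1 ∷ 4 ∷ 5 ∷ []) ∷ []) ∷ ((1 ∷ 2 ∷ 6 ∷ []) ∷ (2 ∷ 4 ∷ 6 ∷ []) ∷ (1 ∷ 5 ∷ 6 ∷ []) ∷ []) ∷ []) ∷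
  (((1 ∷ 3 ∷ 0 ∷ []) ∷ (2 ∷ 5 ∷ 0 ∷ []) ∷ []) ∷ ((0 ∷ 2 ∷ 1 ∷ []) ∷ (2 ∷ 3 ∷ 1 ∷ []) ∷ (0 ∷ 5 ∷ 1 ∷ []) ∷ []) ∷ ((0 ∷ 3 ∷ 2 ∷ []) ∷ (1 ∷ 5 ∷ 2 ∷ []) ∷ []) ∷ ((1 ∷ 0 ∷ 3 ∷ []) ∷ (1 ∷ 6 ∷ 3 ∷ []) ∷ (2 ∷ 5 ∷ 3 ∷ []) ∷ []) ∷ [] ∷ ((0 ∷ 3 ∷ 5 ∷ []) ∷ (1 ∷ 2 ∷ 5 ∷ []) ∷ []) ∷ ((1 ∷ 0 ∷ 6 ∷ []) ∷ (1 ∷ 3 ∷ 6 ∷ []) ∷ (2 ∷ 5 ∷ 6 ∷ []) ∷ []) ∷ []) ∷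
  (((1 ∷ 4 ∷ 0 ∷ []) ∷ (2 ∷ 3 ∷ 0 ∷ []) ∷ []) ∷ ((0 ∷ 3 ∷ 1 ∷ []) ∷ (2 ∷ 4 ∷ 1 ∷ []) ∷ []) ∷ ((0 ∷ 1 ∷ 2 ∷ []) ∷ (1 ∷ 3 ∷ 2 ∷ []) ∷ (0 ∷ 4 ∷ 2 ∷ []) ∷ []) ∷ ((1 ∷ 4 ∷ 3 ∷ []) ∷ (2 ∷ 0 ∷ 3 ∷ []) ∷ []) ∷ ((0 ∷ 3 ∷ 4 ∷ []) ∷ (2 ∷ 1 ∷ 4 ∷ []) ∷ []) ∷ [] ∷ ((1 ∷ 4 ∷ 6 ∷ []) ∷ (2 ∷ 0 ∷ 6 ∷ []) ∷ []) ∷ []) ∷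
  (((1 ∷ 2 ∷ 0 ∷ []) ∷ (2 ∷ 4 ∷ 0 ∷ []) ∷ (1 ∷ 5 ∷ 0 ∷ []) ∷ []) ∷ ((0 ∷ 4 ∷ 1 ∷ []) ∷ (2 ∷ 5 ∷ 1 ∷ []) ∷ []) ∷ ((0 ∷ 5 ∷ 2 ∷ []) ∷ (1 ∷ 4 ∷ 2 ∷ []) ∷ []) ∷ ((1 ∷ 2 ∷ 3 ∷ []) ∷ (2 ∷ 4 ∷ 3 ∷ []) ∷ (1 ∷ 5 ∷ 3 ∷ []) ∷ []) ∷ ((0 ∷ 1 ∷ 4 ∷ []) ∷ (2 ∷ 5 ∷ 4 ∷ []) ∷ []) ∷ ((0 ∷ 2 ∷ 5 ∷ []) ∷ (1 ∷ 4 ∷ 5 ∷ []) ∷ []) ∷ [] ∷ []) ∷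
  []

paths₃,₈ : Vec (Vec (List (List ℕ)) 8) 8
paths₃,₈ =
  ([] ∷ ((2 ∷ 5 ∷ 1 ∷ []) ∷ (3 ∷ 4 ∷ 1 ∷ []) ∷ []) ∷ ((1 ∷ 4 ∷ 2 ∷ []) ∷ (3 ∷ 5 ∷ 2 ∷ []) ∷ []) ∷ ((1 ∷ 2 ∷ 3 ∷ []) ∷ (2 ∷ 4 ∷ 3 ∷ []) ∷ (1 ∷ 5 ∷ 3 ∷ []) ∷ []) ∷ ((2 ∷ 5 ∷ 4 ∷ []) ∷ (3 ∷ 1 ∷ 4 ∷ []) ∷ []) ∷ ((1 ∷ 4 ∷ 5 ∷ []) ∷ (3 ∷ 2 ∷ 5 ∷ []) ∷ []) ∷ ((1 ∷ 2 ∷ 6 ∷ []) ∷ (2 ∷ 4 ∷ 6 ∷ []) ∷ (1 ∷ 5 ∷ 6 ∷ []) ∷ []) ∷ ((2 ∷ 5 ∷ 7 ∷ []) ∷ (3 ∷ 1 ∷ 7 ∷ []) ∷ []) ∷ []) ∷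
  (((2 ∷ 5 ∷ 0 ∷ []) ∷ (4 ∷ 3 ∷ 0 ∷ []) ∷ []) ∷ [] ∷ ((0 ∷ 3 ∷ 2 ∷ []) ∷ (3 ∷ 6 ∷ 2 ∷ []) ∷ (0 ∷ 6 ∷ 2 ∷ []) ∷ []) ∷ ((2 ∷ 5 ∷ 3 ∷ []) ∷ (4 ∷ 0 ∷ 3 ∷ []) ∷ []) ∷ ((0 ∷ 2 ∷ 4 ∷ []) ∷ (2 ∷ 3 ∷ 4 ∷ []) ∷ (0 ∷ 5 ∷ 4 ∷ []) ∷ []) ∷ ((0 ∷ 3 ∷ 5 ∷ []) ∷ (3 ∷ 6 ∷ 5 ∷ []) ∷ (0 ∷ 6 ∷ 5 ∷ []) ∷ []) ∷ ((2 ∷ 5 ∷ 6 ∷ []) ∷ (4 ∷ 0 ∷ 6 ∷ []) ∷ []) ∷ ((0 ∷ 2 ∷ 7 ∷ []) ∷ (2 ∷ 3 ∷ 7 ∷ []) ∷ (0 ∷ 5 ∷ 7 ∷ []) ∷ []) ∷ []) ∷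
  (((1 ∷ 4 ∷ 0 ∷ []) ∷ (4 ∷ 7 ∷ 0 ∷ []) ∷ (1 ∷ 7 ∷ 0 ∷ []) ∷ []) ∷ ((0 ∷ 3 ∷ 1 ∷ []) ∷ (3 ∷ 6 ∷ 1 ∷ []) ∷ (0 ∷ 6 ∷ 1 ∷ []) ∷ []) ∷ [] ∷ ((1 ∷ 4 ∷ 3 ∷ []) ∷ (4 ∷ 7 ∷ 3 ∷ []) ∷ (1 ∷ 7 ∷ 3 ∷ []) ∷ []) ∷ ((0 ∷ 3 ∷ 4 ∷ []) ∷ (3 ∷ 6 ∷ 4 ∷ []) ∷ (0 ∷ 6 ∷ 4 ∷ []) ∷ []) ∷ ((0 ∷ 1 ∷ 5 ∷ []) ∷ (1 ∷ 3 ∷ 5 ∷ []) ∷ (0 ∷ 4 ∷ 5 ∷ []) ∷ []) ∷ ((1 ∷ 4 ∷ 6 ∷ []) ∷ (4 ∷ 7 ∷ 6 ∷ []) ∷ (1 ∷ 7 ∷ 6 ∷ []) ∷ []) ∷ ((0 ∷ 3 ∷ 7 ∷ []) ∷ (3 ∷ 6 ∷ 7 ∷ []) ∷ (0 ∷ 6 ∷ 7 ∷ []) ∷ []) ∷ []) ∷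
  (((1 ∷ 2 ∷ 0 ∷ []) ∷ (2 ∷ 4 ∷ 0 ∷ []) ∷ (1 ∷ 5 ∷ 0 ∷ []) ∷ []) ∷ ((0 ∷ 4 ∷ 1 ∷ []) ∷ (2 ∷ 5 ∷ 1 ∷ []) ∷ []) ∷ ((0 ∷ 5 ∷ 2 ∷ []) ∷ (1 ∷ 4 ∷ 2 ∷ []) ∷ []) ∷ [] ∷ ((0 ∷ 1 ∷ 4 ∷ []) ∷ (2 ∷ 5 ∷ 4 ∷ []) ∷ []) ∷ ((0 ∷ 2 ∷ 5 ∷ []) ∷ (1 ∷ 4 ∷ 5 ∷ []) ∷ []) ∷ ((1 ∷ 2 ∷ 6 ∷ []) ∷ (2 ∷ 4 ∷ 6 ∷ []) ∷ (1 ∷ 5 ∷ 6 ∷ []) ∷ []) ∷ ((0 ∷ 1 ∷ 7 ∷ []) ∷ (2 ∷ 5 ∷ 7 ∷ []) ∷ []) ∷ []) ∷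
  (((1 ∷ 3 ∷ 0 ∷ []) ∷ (2 ∷ 5 ∷ 0 ∷ []) ∷ []) ∷ ((0 ∷ 2 ∷ 1 ∷ []) ∷ (2 ∷ 3 ∷ 1 ∷ []) ∷ (0 ∷ 5 ∷ 1 ∷ []) ∷ []) ∷ ((0 ∷ 3 ∷ 2 ∷ []) ∷ (1 ∷ 5 ∷ 2 ∷ []) ∷ []) ∷ ((1 ∷ 0 ∷ 3 ∷ []) ∷ (1 ∷ 6 ∷ 3 ∷ []) ∷ (2 ∷ 5 ∷ 3 ∷ []) ∷ []) ∷ [] ∷ ((0 ∷ 3 ∷ 5 ∷ []) ∷ (1 ∷ 2 ∷ 5 ∷ []) ∷ []) ∷ ((1 ∷ 0 ∷ 6 ∷ []) ∷ (1 ∷ 3 ∷ 6 ∷ []) ∷ (2 ∷ 5 ∷ 6 ∷ []) ∷ []) ∷ ((0 ∷ 2 ∷ 7 ∷ []) ∷ (2 ∷ 3 ∷ 7 ∷ []) ∷ (0 ∷ 5 ∷ 7 ∷ []) ∷ []) ∷ []) ∷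
  (((1 ∷ 4 ∷ 0 ∷ []) ∷ (2 ∷ 3 ∷ 0 ∷ []) ∷ []) ∷ ((0 ∷ 3 ∷ 1 ∷ []) ∷ (2 ∷ 4 ∷ 1 ∷ []) ∷ []) ∷ ((0 ∷ 1 ∷ 2 ∷ []) ∷ (1 ∷ 3 ∷ 2 ∷ []) ∷ (0 ∷ 4 ∷ 2 ∷ []) ∷ []) ∷ ((1 ∷ 4 ∷ 3 ∷ []) ∷ (2 ∷ 0 ∷ 3 ∷ []) ∷ []) ∷ ((0 ∷ 3 ∷ 4 ∷ []) ∷ (2 ∷ 1 ∷ 4 ∷ []) ∷ []) ∷ [] ∷ ((1 ∷ 4 ∷ 6 ∷ []) ∷ (2 ∷ 0 ∷ 6 ∷ []) ∷ []) ∷ ((0 ∷ 3 ∷ 7 ∷ []) ∷ (2 ∷ 1 ∷ 7 ∷ []) ∷ []) ∷ []) ∷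
  (((1 ∷ 2 ∷ 0 ∷ []) ∷ (2 ∷ 4 ∷ 0 ∷ []) ∷ (1 ∷ 5 ∷ 0 ∷ []) ∷ []) ∷ ((0 ∷ 4 ∷ 1 ∷ []) ∷ (2 ∷ 5 ∷ 1 ∷ []) ∷ []) ∷ ((0 ∷ 5 ∷ 2 ∷ []) ∷ (1 ∷ 4 ∷ 2 ∷ []) ∷ []) ∷ ((1 ∷ 2 ∷ 3 ∷ []) ∷ (2 ∷ 4 ∷ 3 ∷ []) ∷ (1 ∷ 5 ∷ 3 ∷ []) ∷ []) ∷ ((0 ∷ 1 ∷ 4 ∷ []) ∷ (2 ∷ 5 ∷ 4 ∷ []) ∷ []) ∷ ((0 ∷ 2 ∷ 5 ∷ []) ∷ (1 ∷ 4 ∷ 5 ∷ []) ∷ []) ∷ [] ∷ ((0 ∷ 1 ∷ 7 ∷ []) ∷ (2 ∷ 5 ∷ 7 ∷ []) ∷ []) ∷ []) ∷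
  (((1 ∷ 3 ∷ 0 ∷ []) ∷ (2 ∷ 5 ∷ 0 ∷ []) ∷ []) ∷ ((0 ∷ 2 ∷ 1 ∷ []) ∷ (2 ∷ 3 ∷ 1 ∷ []) ∷ (0 ∷ 5 ∷ 1 ∷ []) ∷ []) ∷ ((0 ∷ 3 ∷ 2 ∷ []) ∷ (1 ∷ 5 ∷ 2 ∷ []) ∷ []) ∷ ((1 ∷ 0 ∷ 3 ∷ []) ∷ (1 ∷ 6 ∷ 3 ∷ []) ∷ (2 ∷ 5 ∷ 3 ∷ []) ∷ []) ∷ ((0 ∷ 2 ∷ 4 ∷ []) ∷ (2 ∷ 3 ∷ 4 ∷ []) ∷ (0 ∷ 5 ∷ 4 ∷ []) ∷ []) ∷ ((0 ∷ 3 ∷ 5 ∷ []) ∷ (1 ∷ 2 ∷ 5 ∷ []) ∷ []) ∷ ((1 ∷ 0 ∷ 6 ∷ []) ∷ (1 ∷ 3 ∷ 6 ∷ []) ∷ (2 ∷ 5 ∷ 6 ∷ []) ∷ []) ∷ [] ∷ []) ∷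
  []

paths₄,₉ : Vec (Vec (List (List ℕ)) 9) 9
paths₄,₉ =
  ([] ∷ ((2 ∷ 6 ∷ 3 ∷ 1 ∷ []) ∷ (3 ∷ 7 ∷ 5 ∷ 1 ∷ []) ∷ (2 ∷ 6 ∷ 7 ∷ 1 ∷ []) ∷ []) ∷ ((1 ∷ 3 ∷ 4 ∷ 2 ∷ []) ∷ (3 ∷ 5 ∷ 4 ∷ 2 ∷ []) ∷ (1 ∷ 7 ∷ 4 ∷ 2 ∷ []) ∷ (1 ∷ 3 ∷ 8 ∷ 2 ∷ []) ∷ []) ∷ ((2 ∷ 1 ∷ 5 ∷ 3 ∷ []) ∷ (4 ∷ 2 ∷ 6 ∷ 3 ∷ []) ∷ (6 ∷ 1 ∷ 5 ∷ 3 ∷ []) ∷ []) ∷ ((1 ∷ 2 ∷ 8 ∷ 4 ∷ []) ∷ (1 ∷ 3 ∷ 7 ∷ 4 ∷ []) ∷ (2 ∷ 3 ∷ 8 ∷ 4 ∷ []) ∷ []) ∷ ((2 ∷ 6 ∷ 3 ∷ 5 ∷ []) ∷ (3 ∷ 7 ∷ 1 ∷ 5 ∷ []) ∷ (2 ∷ 6 ∷ 7 ∷ 5 ∷ []) ∷ []) ∷ ((1 ∷ 3 ∷ 4 ∷ 6 ∷ []) ∷ (2 ∷ 3 ∷ 5 ∷ 6 ∷ []) ∷ (1 ∷ 7 ∷ 4 ∷ 6 ∷ []) ∷ []) ∷ ((2 ∷ 1 ∷ 5 ∷ 7 ∷ []) ∷ (4 ∷ 2 ∷ 6 ∷ 7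 ∷ []) ∷ (6 ∷ 1 ∷ 5 ∷ 7 ∷ []) ∷ []) ∷ ((1 ∷ 2 ∷ 4 ∷ 8 ∷ []) ∷ (2 ∷ 3 ∷ 4 ∷ 8 ∷ []) ∷ (1 ∷ 3 ∷ 7 ∷ 8 ∷ []) ∷ []) ∷ []) ∷
  (((3 ∷ 2 ∷ 6 ∷ 0 ∷ []) ∷ (5 ∷ 3 ∷ 7 ∷ 0 ∷ []) ∷ (5 ∷ 2 ∷ 4 ∷ 0 ∷ []) ∷ []) ∷ [] ∷ ((0 ∷ 4 ∷ 6 ∷ 2 ∷ []) ∷ (3 ∷ 7 ∷ 6 ∷ 2 ∷ []) ∷ (5 ∷ 3 ∷ 0 ∷ 2 ∷ []) ∷ []) ∷ ((0 ∷ 2 ∷ 5 ∷ 3 ∷ []) ∷ (2 ∷ 4 ∷ 5 ∷ 3 ∷ []) ∷ (0 ∷ 4 ∷ 7 ∷ 3 ∷ []) ∷ []) ∷ ((3 ∷ 2 ∷ 6 ∷ 4 ∷ []) ∷ (5 ∷ 3 ∷ 7 ∷ 4 ∷ []) ∷ (5 ∷ 2 ∷ 0 ∷ 4 ∷ []) ∷ []) ∷ ((0 ∷ 3 ∷ 7 ∷ 5 ∷ []) ∷ (2 ∷ 3 ∷ 7 ∷ 5 ∷ []) ∷ (0 ∷ 4 ∷ 2 ∷ 5 ∷ []) ∷ []) ∷ ((0 ∷ 4 ∷ 2 ∷ 6 ∷ []) ∷ (3 ∷ 7 ∷ 2 ∷ 6 ∷ []) ∷ (5 ∷ 3 ∷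 0 ∷ 6 ∷ []) ∷ []) ∷ ((0 ∷ 2 ∷ 5 ∷ 7 ∷ []) ∷ (2 ∷ 4 ∷ 5 ∷ 7 ∷ []) ∷ (0 ∷ 4 ∷ 3 ∷ 7 ∷ []) ∷ []) ∷ ((3 ∷ 2 ∷ 6 ∷ 8 ∷ []) ∷ (5 ∷ 3 ∷ 7 ∷ 8 ∷ []) ∷ (5 ∷ 2 ∷ 0 ∷ 8 ∷ []) ∷ []) ∷ []) ∷
  (((1 ∷ 3 ∷ 6 ∷ 0 ∷ []) ∷ (3 ∷ 5 ∷ 6 ∷ 0 ∷ []) ∷ (1 ∷ 7 ∷ 6 ∷ 0 ∷ []) ∷ (3 ∷ 7 ∷ 4 ∷ 0 ∷ []) ∷ []) ∷ ((0 ∷ 3 ∷ 5 ∷ 1 ∷ []) ∷ (4 ∷ 3 ∷ 5 ∷ 1 ∷ []) ∷ (0 ∷ 7 ∷ 5 ∷ 1 ∷ []) ∷ (6 ∷ 0 ∷ 4 ∷ 1 ∷ []) ∷ []) ∷ [] ∷ ((1 ∷ 5 ∷ 7 ∷ 3 ∷ []) ∷ (6 ∷ 0 ∷ 5 ∷ 3 ∷ []) ∷ (6 ∷ 0 ∷ 1 ∷ 3 ∷ []) ∷ []) ∷ ((0 ∷ 1 ∷ 3 ∷ 4 ∷ []) ∷ (1 ∷ 3 ∷ 6 ∷ 4 ∷ []) ∷ (0 ∷ 3 ∷ 5 ∷ 4 ∷ []) ∷ (0 ∷ 1 ∷ 7 ∷ 4 ∷ []) ∷ []) ∷ ((0 ∷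 3 ∷ 1 ∷ 5 ∷ []) ∷ (4 ∷ 3 ∷ 1 ∷ 5 ∷ []) ∷ (6 ∷ 0 ∷ 4 ∷ 5 ∷ []) ∷ []) ∷ ((0 ∷ 4 ∷ 1 ∷ 6 ∷ []) ∷ (1 ∷ 3 ∷ 7 ∷ 6 ∷ []) ∷ (0 ∷ 4 ∷ 3 ∷ 6 ∷ []) ∷ []) ∷ ((1 ∷ 5 ∷ 3 ∷ 7 ∷ []) ∷ (6 ∷ 0 ∷ 5 ∷ 7 ∷ []) ∷ (6 ∷ 0 ∷ 1 ∷ 7 ∷ []) ∷ []) ∷ ((0 ∷ 1 ∷ 3 ∷ 8 ∷ []) ∷ (1 ∷ 3 ∷ 6 ∷ 8 ∷ []) ∷ (0 ∷ 3 ∷ 5 ∷ 8 ∷ []) ∷ (0 ∷ 1 ∷ 7 ∷ 8 ∷ []) ∷ []) ∷ []) ∷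
  (((1 ∷ 5 ∷ 2 ∷ 0 ∷ []) ∷ (2 ∷ 6 ∷ 4 ∷ 0 ∷ []) ∷ (1 ∷ 5 ∷ 6 ∷ 0 ∷ []) ∷ []) ∷ ((0 ∷ 2 ∷ 7 ∷ 1 ∷ []) ∷ (2 ∷ 4 ∷ 7 ∷ 1 ∷ []) ∷ (0 ∷ 6 ∷ 7 ∷ 1 ∷ []) ∷ (5 ∷ 0 ∷ 2 ∷ 1 ∷ []) ∷ []) ∷ ((1 ∷ 0 ∷ 6 ∷ 2 ∷ []) ∷ (1 ∷ 4 ∷ 6 ∷ 2 ∷ []) ∷ (5 ∷ 0 ∷ 6 ∷ 2 ∷ []) ∷ (7 ∷ 1 ∷ 5 ∷ 2 ∷ []) ∷ []) ∷ [] ∷ ((1 ∷ 5 ∷ 2 ∷ 4 ∷ []) ∷ (2 ∷ 6 ∷ 0 ∷ 4 ∷ []) ∷ (1 ∷ 5 ∷ 6 ∷ 4 ∷ []) ∷ []) ∷ ((0 ∷ 2 ∷ 7 ∷ 5 ∷ []) ∷ (1 ∷ 2 ∷ 4 ∷ 5 ∷ []) ∷ (0 ∷ 6 ∷ 7 ∷ 5 ∷ []) ∷ []) ∷ ((1 ∷ 0 ∷ 2 ∷ 6 ∷ []) ∷ (1 ∷ 4 ∷ 2 ∷ 6 ∷ []) ∷ (5 ∷ 0 ∷ 2 ∷ 6 ∷ []) ∷ (7 ∷ 1 ∷ 5 ∷ 6 ∷ []) ∷ []) ∷ ((0 ∷ 4 ∷ 2 ∷ 7 ∷ []) ∷ (2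 ∷ 4 ∷ 8 ∷ 7 ∷ []) ∷ (0 ∷ 4 ∷ 6 ∷ 7 ∷ []) ∷ (0 ∷ 8 ∷ 2 ∷ 7 ∷ []) ∷ []) ∷ ((1 ∷ 5 ∷ 2 ∷ 8 ∷ []) ∷ (2 ∷ 6 ∷ 0 ∷ 8 ∷ []) ∷ (1 ∷ 5 ∷ 6 ∷ 8 ∷ []) ∷ []) ∷ []) ∷
  (((1 ∷ 2 ∷ 8 ∷ 0 ∷ []) ∷ (1 ∷ 3 ∷ 7 ∷ 0 ∷ []) ∷ (2 ∷ 3 ∷ 8 ∷ 0 ∷ []) ∷ []) ∷ ((0 ∷ 2 ∷ 5 ∷ 1 ∷ []) ∷ (2 ∷ 6 ∷ 3 ∷ 1 ∷ []) ∷ (0 ∷ 6 ∷ 5 ∷ 1 ∷ []) ∷ []) ∷ ((0 ∷ 3 ∷ 7 ∷ 2 ∷ []) ∷ (1 ∷ 3 ∷ 8 ∷ 2 ∷ []) ∷ (1 ∷ 7 ∷ 0 ∷ 2 ∷ []) ∷ []) ∷ ((0 ∷ 2 ∷ 6 ∷ 3 ∷ []) ∷ (2 ∷ 1 ∷ 5 ∷ 3 ∷ []) ∷ (6 ∷ 1 ∷ 5 ∷ 3 ∷ []) ∷ []) ∷ [] ∷ ((0 ∷ 2 ∷ 1 ∷ 5 ∷ []) ∷ (2 ∷ 6 ∷ 3 ∷ 5 ∷ []) ∷ (0 ∷ 6 ∷ 1 ∷ 5 ∷ []) ∷ []) ∷ ((0 ∷ 3 ∷ 7 ∷ 6 ∷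 []) ∷ (1 ∷ 3 ∷ 8 ∷ 6 ∷ []) ∷ (1 ∷ 7 ∷ 0 ∷ 6 ∷ []) ∷ []) ∷ ((0 ∷ 2 ∷ 6 ∷ 7 ∷ []) ∷ (2 ∷ 1 ∷ 5 ∷ 7 ∷ []) ∷ (6 ∷ 1 ∷ 5 ∷ 7 ∷ []) ∷ []) ∷ ((0 ∷ 1 ∷ 2 ∷ 8 ∷ []) ∷ (1 ∷ 3 ∷ 7 ∷ 8 ∷ []) ∷ (0 ∷ 2 ∷ 3 ∷ 8 ∷ []) ∷ []) ∷ []) ∷
  (((1 ∷ 2 ∷ 4 ∷ 0 ∷ []) ∷ (3 ∷ 2 ∷ 6 ∷ 0 ∷ []) ∷ (1 ∷ 3 ∷ 7 ∷ 0 ∷ []) ∷ []) ∷ ((0 ∷ 3 ∷ 7 ∷ 1 ∷ []) ∷ (2 ∷ 3 ∷ 7 ∷ 1 ∷ []) ∷ (0 ∷ 4 ∷ 2 ∷ 1 ∷ []) ∷ []) ∷ ((0 ∷ 4 ∷ 6 ∷ 2 ∷ []) ∷ (1 ∷ 3 ∷ 4 ∷ 2 ∷ []) ∷ (0 ∷ 8 ∷ 6 ∷ 2 ∷ []) ∷ []) ∷ ((0 ∷ 2 ∷ 1 ∷ 3 ∷ []) ∷ (2 ∷ 4 ∷ 1 ∷ 3 ∷ []) ∷ (0 ∷ 4 ∷ 7 ∷ 3 ∷ []) ∷ []) ∷ ((1 ∷ 2 ∷ 0 ∷ 4 ∷ []) ∷ (1 ∷ 2 ∷ 8 ∷ 4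 ∷ []) ∷ (3 ∷ 2 ∷ 6 ∷ 4 ∷ []) ∷ (1 ∷ 3 ∷ 7 ∷ 4 ∷ []) ∷ []) ∷ [] ∷ ((0 ∷ 4 ∷ 2 ∷ 6 ∷ []) ∷ (1 ∷ 3 ∷ 4 ∷ 6 ∷ []) ∷ (0 ∷ 8 ∷ 2 ∷ 6 ∷ []) ∷ []) ∷ ((0 ∷ 2 ∷ 1 ∷ 7 ∷ []) ∷ (2 ∷ 4 ∷ 1 ∷ 7 ∷ []) ∷ (0 ∷ 4 ∷ 3 ∷ 7 ∷ []) ∷ []) ∷ ((1 ∷ 2 ∷ 0 ∷ 8 ∷ []) ∷ (1 ∷ 2 ∷ 4 ∷ 8 ∷ []) ∷ (3 ∷ 2 ∷ 6 ∷ 8 ∷ []) ∷ (1 ∷ 3 ∷ 7 ∷ 8 ∷ []) ∷ []) ∷ []) ∷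
  (((1 ∷ 3 ∷ 2 ∷ 0 ∷ []) ∷ (3 ∷ 5 ∷ 2 ∷ 0 ∷ []) ∷ (3 ∷ 7 ∷ 4 ∷ 0 ∷ []) ∷ (1 ∷ 7 ∷ 2 ∷ 0 ∷ []) ∷ []) ∷ ((0 ∷ 3 ∷ 5 ∷ 1 ∷ []) ∷ (2 ∷ 3 ∷ 7 ∷ 1 ∷ []) ∷ (0 ∷ 7 ∷ 5 ∷ 1 ∷ []) ∷ []) ∷ ((0 ∷ 4 ∷ 1 ∷ 2 ∷ []) ∷ (1 ∷ 3 ∷ 7 ∷ 2 ∷ []) ∷ (0 ∷ 4 ∷ 3 ∷ 2 ∷ []) ∷ []) ∷ ((1 ∷ 5 ∷ 7 ∷ 3 ∷ []) ∷ (2 ∷ 0 ∷ 5 ∷ 3 ∷ []) ∷ (2 ∷ 0 ∷ 1 ∷ 3 ∷ []) ∷ []) ∷ ((0 ∷ 1 ∷ 3 ∷ 4 ∷ []) ∷ (1 ∷ 3 ∷ 2 ∷ 4 ∷ []) ∷ (0 ∷ 3 ∷ 5 ∷ 4 ∷ []) ∷ (0 ∷ 1 ∷ 7 ∷ 4 ∷ []) ∷ []) ∷ ((0 ∷ 3 ∷ 1 ∷ 5 ∷ []) ∷ (2 ∷ 3 ∷ 7 ∷ 5 ∷ []) ∷ (0 ∷ 7 ∷ 1 ∷ 5 ∷ []) ∷ []) ∷ [] ∷ ((1 ∷ 5 ∷ 3 ∷ 7 ∷ []) ∷ (2 ∷ 0 ∷ 5 ∷ 7 ∷ []) ∷ (2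 ∷ 0 ∷ 1 ∷ 7 ∷ []) ∷ []) ∷ ((0 ∷ 1 ∷ 3 ∷ 8 ∷ []) ∷ (1 ∷ 3 ∷ 2 ∷ 8 ∷ []) ∷ (0 ∷ 3 ∷ 5 ∷ 8 ∷ []) ∷ (0 ∷ 1 ∷ 7 ∷ 8 ∷ []) ∷ []) ∷ []) ∷
  (((1 ∷ 5 ∷ 2 ∷ 0 ∷ []) ∷ (2 ∷ 6 ∷ 4 ∷ 0 ∷ []) ∷ (1 ∷ 5 ∷ 6 ∷ 0 ∷ []) ∷ []) ∷ ((0 ∷ 2 ∷ 3 ∷ 1 ∷ []) ∷ (2 ∷ 4 ∷ 3 ∷ 1 ∷ []) ∷ (0 ∷ 6 ∷ 3 ∷ 1 ∷ []) ∷ (5 ∷ 0 ∷ 2 ∷ 1 ∷ []) ∷ []) ∷ ((1 ∷ 0 ∷ 6 ∷ 2 ∷ []) ∷ (1 ∷ 4 ∷ 6 ∷ 2 ∷ []) ∷ (5 ∷ 0 ∷ 6 ∷ 2 ∷ []) ∷ (3 ∷ 1 ∷ 5 ∷ 2 ∷ []) ∷ []) ∷ ((0 ∷ 4 ∷ 2 ∷ 3 ∷ []) ∷ (2 ∷ 4 ∷ 8 ∷ 3 ∷ []) ∷ (0 ∷ 4 ∷ 6 ∷ 3 ∷ []) ∷ (0 ∷ 8 ∷ 2 ∷ 3 ∷ []) ∷ []) ∷ ((1 ∷ 5 ∷ 2 ∷ 4 ∷ []) ∷ (2 ∷ 6 ∷ 0 ∷ 4 ∷ []) ∷ (1 ∷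 5 ∷ 6 ∷ 4 ∷ []) ∷ []) ∷ ((0 ∷ 2 ∷ 3 ∷ 5 ∷ []) ∷ (1 ∷ 2 ∷ 4 ∷ 5 ∷ []) ∷ (0 ∷ 6 ∷ 3 ∷ 5 ∷ []) ∷ []) ∷ ((1 ∷ 0 ∷ 2 ∷ 6 ∷ []) ∷ (1 ∷ 4 ∷ 2 ∷ 6 ∷ []) ∷ (5 ∷ 0 ∷ 2 ∷ 6 ∷ []) ∷ (3 ∷ 1 ∷ 5 ∷ 6 ∷ []) ∷ []) ∷ [] ∷ ((1 ∷ 5 ∷ 2 ∷ 8 ∷ []) ∷ (2 ∷ 6 ∷ 0 ∷ 8 ∷ []) ∷ (1 ∷ 5 ∷ 6 ∷ 8 ∷ []) ∷ []) ∷ []) ∷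
  (((1 ∷ 2 ∷ 4 ∷ 0 ∷ []) ∷ (2 ∷ 3 ∷ 4 ∷ 0 ∷ []) ∷ (1 ∷ 3 ∷ 7 ∷ 0 ∷ []) ∷ []) ∷ ((0 ∷ 2 ∷ 5 ∷ 1 ∷ []) ∷ (2 ∷ 6 ∷ 3 ∷ 1 ∷ []) ∷ (0 ∷ 6 ∷ 5 ∷ 1 ∷ []) ∷ []) ∷ ((0 ∷ 3 ∷ 7 ∷ 2 ∷ []) ∷ (1 ∷ 3 ∷ 4 ∷ 2 ∷ []) ∷ (1 ∷ 7 ∷ 0 ∷ 2 ∷ []) ∷ []) ∷ ((0 ∷ 2 ∷ 6 ∷ 3 ∷ []) ∷ (2 ∷ 1 ∷ 5 ∷ 3 ∷ []) ∷ (6 ∷ 1 ∷ 5 ∷ 3 ∷ []) ∷ []) ∷ ((0 ∷ 1 ∷ 2 ∷ 4 ∷ []) ∷ (1 ∷ 3 ∷ 7 ∷ 4 ∷ []) ∷ (0 ∷ 2 ∷ 3 ∷ 4 ∷ []) ∷ []) ∷ ((0 ∷ 2 ∷ 1 ∷ 5 ∷ []) ∷ (2 ∷ 6 ∷ 3 ∷ 5 ∷ []) ∷ (0 ∷ 6 ∷ 1 ∷ 5 ∷ []) ∷ []) ∷ ((0 ∷ 3 ∷ 7 ∷ 6 ∷ []) ∷ (1 ∷ 3 ∷ 4 ∷ 6 ∷ []) ∷ (1 ∷ 7 ∷ 0 ∷ 6 ∷ []) ∷ []) ∷ ((0 ∷ 2 ∷ 6 ∷ 7 ∷ []) ∷ (2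 ∷ 1 ∷ 5 ∷ 7 ∷ []) ∷ (6 ∷ 1 ∷ 5 ∷ 7 ∷ []) ∷ []) ∷ [] ∷ []) ∷
  []

paths₄,₁₀ : Vec (Vec (List (List ℕ)) 10) 10
paths₄,₁₀ =
  ([] ∷ ((2 ∷ 6 ∷ 3 ∷ 1 ∷ []) ∷ (3 ∷ 7 ∷ 5 ∷ 1 ∷ []) ∷ (2 ∷ 6 ∷ 7 ∷ 1 ∷ []) ∷ []) ∷ ((1 ∷ 3 ∷ 4 ∷ 2 ∷ []) ∷ (3 ∷ 5 ∷ 4 ∷ 2 ∷ []) ∷ (1 ∷ 7 ∷ 4 ∷ 2 ∷ []) ∷ (1 ∷ 3 ∷ 8 ∷ 2 ∷ []) ∷ []) ∷ ((2 ∷ 1 ∷ 5 ∷ 3 ∷ []) ∷ (2 ∷ 5 ∷ 9 ∷ 3 ∷ []) ∷ (6 ∷ 1 ∷ 5 ∷ 3 ∷ []) ∷ (2 ∷ 1 ∷ 9 ∷ 3 ∷ []) ∷ []) ∷ ((1 ∷ 2 ∷ 8 ∷ 4 ∷ []) ∷ (1 ∷ 3 ∷ 7 ∷ 4 ∷ []) ∷ (2 ∷ 3 ∷ 8 ∷ 4 ∷ []) ∷ []) ∷ ((2 ∷ 6 ∷ 3 ∷ 5 ∷ []) ∷ (3 ∷ 7 ∷ 1 ∷ 5 ∷ []) ∷ (2 ∷ 6 ∷ 7 ∷ 5 ∷ []) ∷ []) ∷ ((1 ∷ 3 ∷ 4 ∷ 6 ∷ []) ∷ (2 ∷ 3 ∷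 5 ∷ 6 ∷ []) ∷ (1 ∷ 7 ∷ 4 ∷ 6 ∷ []) ∷ []) ∷ ((2 ∷ 1 ∷ 5 ∷ 7 ∷ []) ∷ (2 ∷ 5 ∷ 9 ∷ 7 ∷ []) ∷ (6 ∷ 1 ∷ 5 ∷ 7 ∷ []) ∷ (2 ∷ 1 ∷ 9 ∷ 7 ∷ []) ∷ []) ∷ ((1 ∷ 2 ∷ 4 ∷ 8 ∷ []) ∷ (2 ∷ 3 ∷ 4 ∷ 8 ∷ []) ∷ (1 ∷ 3 ∷ 7 ∷ 8 ∷ []) ∷ []) ∷ ((2 ∷ 6 ∷ 3 ∷ 9 ∷ []) ∷ (3 ∷ 7 ∷ 1 ∷ 9 ∷ []) ∷ (2 ∷ 6 ∷ 7 ∷ 9 ∷ []) ∷ []) ∷ []) ∷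
  (((3 ∷ 2 ∷ 6 ∷ 0 ∷ []) ∷ (5 ∷ 3 ∷ 7 ∷ 0 ∷ []) ∷ (5 ∷ 2 ∷ 4 ∷ 0 ∷ []) ∷ []) ∷ [] ∷ ((0 ∷ 4 ∷ 6 ∷ 2 ∷ []) ∷ (3 ∷ 7 ∷ 6 ∷ 2 ∷ []) ∷ (5 ∷ 3 ∷ 0 ∷ 2 ∷ []) ∷ []) ∷ ((0 ∷ 2 ∷ 5 ∷ 3 ∷ []) ∷ (2 ∷ 4 ∷ 5 ∷ 3 ∷ []) ∷ (0 ∷ 4 ∷ 7 ∷ 3 ∷ []) ∷ []) ∷ ((3 ∷ 2 ∷ 6 ∷ 4 ∷ []) ∷ (5 ∷ 3 ∷ 7 ∷ 4 ∷ []) ∷ (5 ∷ 2 ∷ 0 ∷ 4 ∷ []) ∷ []) ∷ ((0 ∷ 3 ∷ 7 ∷ 5 ∷ []) ∷ (2 ∷ 3 ∷ 7 ∷ 5 ∷ []) ∷ (0 ∷ 4 ∷ 2 ∷ 5 ∷ []) ∷ []) ∷ ((0 ∷ 4 ∷ 2 ∷ 6 ∷ []) ∷ (3 ∷ 7 ∷ 2 ∷ 6 ∷ []) ∷ (5 ∷ 3 ∷ 0 ∷ 6 ∷ []) ∷ []) ∷ ((0 ∷ 2 ∷ 5 ∷ 7 ∷ []) ∷ (2 ∷ 4 ∷ 5 ∷ 7 ∷ []) ∷ (0 ∷ 4 ∷ 3 ∷ 7 ∷ []) ∷ []) ∷ ((3 ∷ 2 ∷ 6 ∷ 8 ∷ [])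 ∷ (5 ∷ 3 ∷ 7 ∷ 8 ∷ []) ∷ (5 ∷ 2 ∷ 0 ∷ 8 ∷ []) ∷ []) ∷ ((0 ∷ 3 ∷ 7 ∷ 9 ∷ []) ∷ (2 ∷ 3 ∷ 7 ∷ 9 ∷ []) ∷ (0 ∷ 4 ∷ 2 ∷ 9 ∷ []) ∷ []) ∷ []) ∷
  (((1 ∷ 3 ∷ 6 ∷ 0 ∷ []) ∷ (3 ∷ 5 ∷ 6 ∷ 0 ∷ []) ∷ (1 ∷ 7 ∷ 6 ∷ 0 ∷ []) ∷ (3 ∷ 7 ∷ 4 ∷ 0 ∷ []) ∷ []) ∷ ((0 ∷ 3 ∷ 5 ∷ 1 ∷ []) ∷ (4 ∷ 3 ∷ 5 ∷ 1 ∷ []) ∷ (0 ∷ 7 ∷ 5 ∷ 1 ∷ []) ∷ (0 ∷ 3 ∷ 9 ∷ 1 ∷ []) ∷ []) ∷ [] ∷ ((1 ∷ 5 ∷ 7 ∷ 3 ∷ []) ∷ (5 ∷ 9 ∷ 7 ∷ 3 ∷ []) ∷ (1 ∷ 9 ∷ 7 ∷ 3 ∷ []) ∷ (6 ∷ 0 ∷ 1 ∷ 3 ∷ []) ∷ []) ∷ ((0 ∷ 1 ∷ 3 ∷ 4 ∷ []) ∷ (1 ∷ 3 ∷ 6 ∷ 4 ∷ []) ∷ (0 ∷ 3 ∷ 5 ∷ 4 ∷ []) ∷ (0 ∷ 1 ∷ 7 ∷ 4 ∷ []) ∷ []) ∷ ((0 ∷ 3 ∷ 1 ∷ 5 ∷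 []) ∷ (4 ∷ 3 ∷ 1 ∷ 5 ∷ []) ∷ (0 ∷ 3 ∷ 9 ∷ 5 ∷ []) ∷ (0 ∷ 7 ∷ 1 ∷ 5 ∷ []) ∷ []) ∷ ((0 ∷ 4 ∷ 1 ∷ 6 ∷ []) ∷ (1 ∷ 3 ∷ 7 ∷ 6 ∷ []) ∷ (0 ∷ 4 ∷ 3 ∷ 6 ∷ []) ∷ []) ∷ ((1 ∷ 5 ∷ 3 ∷ 7 ∷ []) ∷ (5 ∷ 9 ∷ 3 ∷ 7 ∷ []) ∷ (6 ∷ 0 ∷ 1 ∷ 7 ∷ []) ∷ []) ∷ ((0 ∷ 1 ∷ 3 ∷ 8 ∷ []) ∷ (1 ∷ 3 ∷ 6 ∷ 8 ∷ []) ∷ (0 ∷ 3 ∷ 5 ∷ 8 ∷ []) ∷ (0 ∷ 1 ∷ 7 ∷ 8 ∷ []) ∷ []) ∷ ((0 ∷ 3 ∷ 1 ∷ 9 ∷ []) ∷ (4 ∷ 3 ∷ 1 ∷ 9 ∷ []) ∷ (0 ∷ 3 ∷ 5 ∷ 9 ∷ []) ∷ (0 ∷ 7 ∷ 1 ∷ 9 ∷ []) ∷ []) ∷ []) ∷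
  (((1 ∷ 5 ∷ 2 ∷ 0 ∷ []) ∷ (2 ∷ 6 ∷ 4 ∷ 0 ∷ []) ∷ (1 ∷ 5 ∷ 6 ∷ 0 ∷ []) ∷ []) ∷ ((0 ∷ 2 ∷ 7 ∷ 1 ∷ []) ∷ (2 ∷ 4 ∷ 7 ∷ 1 ∷ []) ∷ (0 ∷ 6 ∷ 7 ∷ 1 ∷ []) ∷ (5 ∷ 0 ∷ 2 ∷ 1 ∷ []) ∷ []) ∷ ((1 ∷ 0 ∷ 6 ∷ 2 ∷ []) ∷ (1 ∷ 4 ∷ 6 ∷ 2 ∷ []) ∷ (5 ∷ 0 ∷ 6 ∷ 2 ∷ []) ∷ (7 ∷ 1 ∷ 5 ∷ 2 ∷ []) ∷ []) ∷ [] ∷ ((1 ∷ 5 ∷ 2 ∷ 4 ∷ []) ∷ (2 ∷ 6 ∷ 0 ∷ 4 ∷ []) ∷ (1 ∷ 5 ∷ 6 ∷ 4 ∷ []) ∷ []) ∷ ((0 ∷ 2 ∷ 7 ∷ 5 ∷ []) ∷ (1 ∷ 2 ∷ 4 ∷ 5 ∷ []) ∷ (0 ∷ 6 ∷ 7 ∷ 5 ∷ []) ∷ []) ∷ ((1 ∷ 0 ∷ 2 ∷ 6 ∷ []) ∷ (1 ∷ 4 ∷ 2 ∷ 6 ∷ []) ∷ (5 ∷ 0 ∷ 2 ∷ 6 ∷ []) ∷ (7 ∷ 1 ∷ 5 ∷ 6 ∷ []) ∷ []) ∷ ((0 ∷ 4 ∷ 2 ∷ 7 ∷ []) ∷ (2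 ∷ 4 ∷ 8 ∷ 7 ∷ []) ∷ (0 ∷ 4 ∷ 6 ∷ 7 ∷ []) ∷ (0 ∷ 8 ∷ 2 ∷ 7 ∷ []) ∷ []) ∷ ((1 ∷ 5 ∷ 2 ∷ 8 ∷ []) ∷ (2 ∷ 6 ∷ 0 ∷ 8 ∷ []) ∷ (1 ∷ 5 ∷ 6 ∷ 8 ∷ []) ∷ []) ∷ ((0 ∷ 2 ∷ 7 ∷ 9 ∷ []) ∷ (1 ∷ 2 ∷ 4 ∷ 9 ∷ []) ∷ (0 ∷ 6 ∷ 7 ∷ 9 ∷ []) ∷ []) ∷ []) ∷
  (((1 ∷ 2 ∷ 8 ∷ 0 ∷ []) ∷ (1 ∷ 3 ∷ 7 ∷ 0 ∷ []) ∷ (2 ∷ 3 ∷ 8 ∷ 0 ∷ []) ∷ []) ∷ ((0 ∷ 2 ∷ 5 ∷ 1 ∷ []) ∷ (2 ∷ 6 ∷ 3 ∷ 1 ∷ []) ∷ (0 ∷ 6 ∷ 5 ∷ 1 ∷ []) ∷ []) ∷ ((0 ∷ 3 ∷ 7 ∷ 2 ∷ []) ∷ (1 ∷ 3 ∷ 8 ∷ 2 ∷ []) ∷ (1 ∷ 7 ∷ 0 ∷ 2 ∷ []) ∷ []) ∷ ((0 ∷ 2 ∷ 6 ∷ 3 ∷ []) ∷ (2 ∷ 1 ∷ 5 ∷ 3 ∷ []) ∷ (6 ∷ 1 ∷ 5 ∷ 3 ∷ []) ∷ []) ∷ [] ∷ ((0 ∷ 2 ∷ 1 ∷ 5 ∷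 []) ∷ (2 ∷ 6 ∷ 3 ∷ 5 ∷ []) ∷ (0 ∷ 6 ∷ 1 ∷ 5 ∷ []) ∷ []) ∷ ((0 ∷ 3 ∷ 7 ∷ 6 ∷ []) ∷ (1 ∷ 3 ∷ 8 ∷ 6 ∷ []) ∷ (1 ∷ 7 ∷ 0 ∷ 6 ∷ []) ∷ []) ∷ ((0 ∷ 2 ∷ 6 ∷ 7 ∷ []) ∷ (2 ∷ 1 ∷ 5 ∷ 7 ∷ []) ∷ (6 ∷ 1 ∷ 5 ∷ 7 ∷ []) ∷ []) ∷ ((0 ∷ 1 ∷ 2 ∷ 8 ∷ []) ∷ (1 ∷ 3 ∷ 7 ∷ 8 ∷ []) ∷ (0 ∷ 2 ∷ 3 ∷ 8 ∷ []) ∷ []) ∷ ((0 ∷ 2 ∷ 1 ∷ 9 ∷ []) ∷ (2 ∷ 6 ∷ 3 ∷ 9 ∷ []) ∷ (0 ∷ 6 ∷ 1 ∷ 9 ∷ []) ∷ []) ∷ []) ∷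
  (((1 ∷ 2 ∷ 4 ∷ 0 ∷ []) ∷ (3 ∷ 2 ∷ 6 ∷ 0 ∷ []) ∷ (1 ∷ 3 ∷ 7 ∷ 0 ∷ []) ∷ []) ∷ ((0 ∷ 3 ∷ 7 ∷ 1 ∷ []) ∷ (2 ∷ 3 ∷ 7 ∷ 1 ∷ []) ∷ (0 ∷ 4 ∷ 2 ∷ 1 ∷ []) ∷ []) ∷ ((0 ∷ 4 ∷ 6 ∷ 2 ∷ []) ∷ (1 ∷ 3 ∷ 4 ∷ 2 ∷ []) ∷ (0 ∷ 8 ∷ 6 ∷ 2 ∷ []) ∷ []) ∷ ((0 ∷ 2 ∷ 1 ∷ 3 ∷ []) ∷ (2 ∷ 4 ∷ 1 ∷ 3 ∷ []) ∷ (0 ∷ 2 ∷ 9 ∷ 3 ∷ []) ∷ (0 ∷ 4 ∷ 7 ∷ 3 ∷ []) ∷ []) ∷ ((1 ∷ 2 ∷ 0 ∷ 4 ∷ []) ∷ (1 ∷ 2 ∷ 8 ∷ 4 ∷ []) ∷ (3 ∷ 2 ∷ 6 ∷ 4 ∷ []) ∷ (1 ∷ 3 ∷ 7 ∷ 4 ∷ []) ∷ []) ∷ [] ∷ ((0 ∷ 4 ∷ 2 ∷ 6 ∷ []) ∷ (1 ∷ 3 ∷ 4 ∷ 6 ∷ []) ∷ (0 ∷ 8 ∷ 2 ∷ 6 ∷ []) ∷ []) ∷ ((0 ∷ 2 ∷ 1 ∷ 7 ∷ []) ∷ (2 ∷ 4 ∷ 1 ∷ 7 ∷ []) ∷ (0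 ∷ 2 ∷ 9 ∷ 7 ∷ []) ∷ (0 ∷ 4 ∷ 3 ∷ 7 ∷ []) ∷ []) ∷ ((1 ∷ 2 ∷ 0 ∷ 8 ∷ []) ∷ (1 ∷ 2 ∷ 4 ∷ 8 ∷ []) ∷ (3 ∷ 2 ∷ 6 ∷ 8 ∷ []) ∷ (1 ∷ 3 ∷ 7 ∷ 8 ∷ []) ∷ []) ∷ ((0 ∷ 3 ∷ 7 ∷ 9 ∷ []) ∷ (2 ∷ 3 ∷ 7 ∷ 9 ∷ []) ∷ (0 ∷ 4 ∷ 2 ∷ 9 ∷ []) ∷ []) ∷ []) ∷
  (((1 ∷ 3 ∷ 2 ∷ 0 ∷ []) ∷ (3 ∷ 5 ∷ 2 ∷ 0 ∷ []) ∷ (3 ∷ 7 ∷ 4 ∷ 0 ∷ []) ∷ (1 ∷ 7 ∷ 2 ∷ 0 ∷ []) ∷ []) ∷ ((0 ∷ 3 ∷ 5 ∷ 1 ∷ []) ∷ (2 ∷ 3 ∷ 7 ∷ 1 ∷ []) ∷ (0 ∷ 7 ∷ 5 ∷ 1 ∷ []) ∷ []) ∷ ((0 ∷ 4 ∷ 1 ∷ 2 ∷ []) ∷ (1 ∷ 3 ∷ 7 ∷ 2 ∷ []) ∷ (0 ∷ 4 ∷ 3 ∷ 2 ∷ []) ∷ []) ∷ ((1 ∷ 5 ∷ 7 ∷ 3 ∷ []) ∷ (2 ∷ 0 ∷ 5 ∷ 3 ∷ []) ∷ (1 ∷ 9 ∷ 7 ∷ 3 ∷ []) ∷ []) ∷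 ((0 ∷ 1 ∷ 3 ∷ 4 ∷ []) ∷ (1 ∷ 3 ∷ 2 ∷ 4 ∷ []) ∷ (0 ∷ 3 ∷ 5 ∷ 4 ∷ []) ∷ (0 ∷ 1 ∷ 7 ∷ 4 ∷ []) ∷ []) ∷ ((0 ∷ 3 ∷ 1 ∷ 5 ∷ []) ∷ (2 ∷ 3 ∷ 7 ∷ 5 ∷ []) ∷ (0 ∷ 7 ∷ 1 ∷ 5 ∷ []) ∷ []) ∷ [] ∷ ((1 ∷ 5 ∷ 3 ∷ 7 ∷ []) ∷ (2 ∷ 0 ∷ 5 ∷ 7 ∷ []) ∷ (1 ∷ 9 ∷ 3 ∷ 7 ∷ []) ∷ []) ∷ ((0 ∷ 1 ∷ 3 ∷ 8 ∷ []) ∷ (1 ∷ 3 ∷ 2 ∷ 8 ∷ []) ∷ (0 ∷ 3 ∷ 5 ∷ 8 ∷ []) ∷ (0 ∷ 1 ∷ 7 ∷ 8 ∷ []) ∷ []) ∷ ((0 ∷ 3 ∷ 1 ∷ 9 ∷ []) ∷ (2 ∷ 3 ∷ 7 ∷ 9 ∷ []) ∷ (0 ∷ 7 ∷ 1 ∷ 9 ∷ []) ∷ []) ∷ []) ∷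
  (((1 ∷ 5 ∷ 2 ∷ 0 ∷ []) ∷ (2 ∷ 6 ∷ 4 ∷ 0 ∷ []) ∷ (1 ∷ 5 ∷ 6 ∷ 0 ∷ []) ∷ []) ∷ ((0 ∷ 2 ∷ 3 ∷ 1 ∷ []) ∷ (2 ∷ 4 ∷ 3 ∷ 1 ∷ []) ∷ (0 ∷ 6 ∷ 3 ∷ 1 ∷ []) ∷ (5 ∷ 0 ∷ 2 ∷ 1 ∷ []) ∷ []) ∷ ((1 ∷ 0 ∷ 6 ∷ 2 ∷ []) ∷ (1 ∷ 4 ∷ 6 ∷ 2 ∷ []) ∷ (3 ∷ 5 ∷ 9 ∷ 2 ∷ []) ∷ []) ∷ ((0 ∷ 4 ∷ 2 ∷ 3 ∷ []) ∷ (2 ∷ 4 ∷ 8 ∷ 3 ∷ []) ∷ (0 ∷ 4 ∷ 6 ∷ 3 ∷ []) ∷ (0 ∷ 8 ∷ 2 ∷ 3 ∷ []) ∷ []) ∷ ((1 ∷ 5 ∷ 2 ∷ 4 ∷ []) ∷ (2 ∷ 6 ∷ 0 ∷ 4 ∷ []) ∷ (1 ∷ 5 ∷ 6 ∷ 4 ∷ []) ∷ []) ∷ ((0 ∷ 2 ∷ 3 ∷ 5 ∷ []) ∷ (1 ∷ 2 ∷ 4 ∷ 5 ∷ []) ∷ (0 ∷ 6 ∷ 3 ∷ 5 ∷ []) ∷ []) ∷ ((1 ∷ 0 ∷ 2 ∷ 6 ∷ []) ∷ (1 ∷ 4 ∷ 2 ∷ 6 ∷ []) ∷ (3 ∷ 5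 ∷ 9 ∷ 6 ∷ []) ∷ []) ∷ [] ∷ ((1 ∷ 5 ∷ 2 ∷ 8 ∷ []) ∷ (2 ∷ 6 ∷ 0 ∷ 8 ∷ []) ∷ (1 ∷ 5 ∷ 6 ∷ 8 ∷ []) ∷ []) ∷ ((0 ∷ 2 ∷ 3 ∷ 9 ∷ []) ∷ (1 ∷ 2 ∷ 4 ∷ 9 ∷ []) ∷ (0 ∷ 6 ∷ 3 ∷ 9 ∷ []) ∷ []) ∷ []) ∷
  (((1 ∷ 2 ∷ 4 ∷ 0 ∷ []) ∷ (2 ∷ 3 ∷ 4 ∷ 0 ∷ []) ∷ (1 ∷ 3 ∷ 7 ∷ 0 ∷ []) ∷ []) ∷ ((0 ∷ 2 ∷ 5 ∷ 1 ∷ []) ∷ (2 ∷ 6 ∷ 3 ∷ 1 ∷ []) ∷ (0 ∷ 6 ∷ 5 ∷ 1 ∷ []) ∷ []) ∷ ((0 ∷ 3 ∷ 7 ∷ 2 ∷ []) ∷ (1 ∷ 3 ∷ 4 ∷ 2 ∷ []) ∷ (1 ∷ 7 ∷ 0 ∷ 2 ∷ []) ∷ []) ∷ ((0 ∷ 2 ∷ 6 ∷ 3 ∷ []) ∷ (2 ∷ 1 ∷ 5 ∷ 3 ∷ []) ∷ (6 ∷ 1 ∷ 5 ∷ 3 ∷ []) ∷ []) ∷ ((0 ∷ 1 ∷ 2 ∷ 4 ∷ []) ∷ (1 ∷ 3 ∷ 7 ∷ 4 ∷ []) ∷ (0 ∷ 2 ∷ 3 ∷ 4 ∷ []) ∷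 []) ∷ ((0 ∷ 2 ∷ 1 ∷ 5 ∷ []) ∷ (2 ∷ 6 ∷ 3 ∷ 5 ∷ []) ∷ (0 ∷ 6 ∷ 1 ∷ 5 ∷ []) ∷ []) ∷ ((0 ∷ 3 ∷ 7 ∷ 6 ∷ []) ∷ (1 ∷ 3 ∷ 4 ∷ 6 ∷ []) ∷ (1 ∷ 7 ∷ 0 ∷ 6 ∷ []) ∷ []) ∷ ((0 ∷ 2 ∷ 6 ∷ 7 ∷ []) ∷ (2 ∷ 1 ∷ 5 ∷ 7 ∷ []) ∷ (6 ∷ 1 ∷ 5 ∷ 7 ∷ []) ∷ []) ∷ [] ∷ ((0 ∷ 2 ∷ 1 ∷ 9 ∷ []) ∷ (2 ∷ 6 ∷ 3 ∷ 9 ∷ []) ∷ (0 ∷ 6 ∷ 1 ∷ 9 ∷ []) ∷ []) ∷ []) ∷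
  (((1 ∷ 2 ∷ 4 ∷ 0 ∷ []) ∷ (3 ∷ 2 ∷ 6 ∷ 0 ∷ []) ∷ (1 ∷ 3 ∷ 7 ∷ 0 ∷ []) ∷ []) ∷ ((0 ∷ 3 ∷ 7 ∷ 1 ∷ []) ∷ (2 ∷ 3 ∷ 7 ∷ 1 ∷ []) ∷ (0 ∷ 4 ∷ 2 ∷ 1 ∷ []) ∷ []) ∷ ((0 ∷ 4 ∷ 6 ∷ 2 ∷ []) ∷ (1 ∷ 3 ∷ 4 ∷ 2 ∷ []) ∷ (0 ∷ 8 ∷ 6 ∷ 2 ∷ []) ∷ []) ∷ ((0 ∷ 2 ∷ 1 ∷ 3 ∷ []) ∷ (2 ∷ 4 ∷ 1 ∷ 3 ∷ []) ∷ (0 ∷ 2 ∷ 5 ∷ 3 ∷ []) ∷ (0 ∷ 4 ∷ 7 ∷ 3 ∷ []) ∷ []) ∷ ((1 ∷ 2 ∷ 0 ∷ 4 ∷ []) ∷ (1 ∷ 2 ∷ 8 ∷ 4 ∷ []) ∷ (3 ∷ 2 ∷ 6 ∷ 4 ∷ []) ∷ (1 ∷ 3 ∷ 7 ∷ 4 ∷ []) ∷ []) ∷ ((0 ∷ 3 ∷ 7 ∷ 5 ∷ []) ∷ (2 ∷ 3 ∷ 7 ∷ 5 ∷ []) ∷ (0 ∷ 4 ∷ 2 ∷ 5 ∷ []) ∷ []) ∷ ((0 ∷ 4 ∷ 2 ∷ 6 ∷ []) ∷ (1 ∷ 3 ∷ 4 ∷ 6 ∷ []) ∷ (0 ∷ 8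 ∷ 2 ∷ 6 ∷ []) ∷ []) ∷ ((0 ∷ 2 ∷ 1 ∷ 7 ∷ []) ∷ (2 ∷ 4 ∷ 1 ∷ 7 ∷ []) ∷ (0 ∷ 2 ∷ 5 ∷ 7 ∷ []) ∷ (0 ∷ 4 ∷ 3 ∷ 7 ∷ []) ∷ []) ∷ ((1 ∷ 2 ∷ 0 ∷ 8 ∷ []) ∷ (1 ∷ 2 ∷ 4 ∷ 8 ∷ []) ∷ (3 ∷ 2 ∷ 6 ∷ 8 ∷ []) ∷ (1 ∷ 3 ∷ 7 ∷ 8 ∷ []) ∷ []) ∷ [] ∷ []) ∷
  []

paths₄,₁₁ : Vec (Vec (List (List ℕ)) 11) 11
paths₄,₁₁ =
  ([] ∷ ((2 ∷ 6 ∷ 3 ∷ 1 ∷ []) ∷ (3 ∷ 7 ∷ 5 ∷ 1 ∷ []) ∷ (2 ∷ 6 ∷ 7 ∷ 1 ∷ []) ∷ []) ∷ ((1 ∷ 3 ∷ 4 ∷ 2 ∷ []) ∷ (3 ∷ 5 ∷ 4 ∷ 2 ∷ []) ∷ (1 ∷ 7 ∷ 4 ∷ 2 ∷ []) ∷ (1 ∷ 3 ∷ 8 ∷ 2 ∷ []) ∷ []) ∷ ((2 ∷ 1 ∷ 5 ∷ 3 ∷ []) ∷ (2 ∷ 5 ∷ 9 ∷ 3 ∷ []) ∷ (4 ∷ 6 ∷ 10 ∷ 3 ∷ []) ∷ []) ∷ ((1 ∷ 2 ∷ 8 ∷ 4 ∷ []) ∷ (1 ∷ 3 ∷ 7 ∷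 4 ∷ []) ∷ (2 ∷ 3 ∷ 8 ∷ 4 ∷ []) ∷ []) ∷ ((2 ∷ 6 ∷ 3 ∷ 5 ∷ []) ∷ (3 ∷ 7 ∷ 1 ∷ 5 ∷ []) ∷ (2 ∷ 6 ∷ 7 ∷ 5 ∷ []) ∷ []) ∷ ((1 ∷ 3 ∷ 4 ∷ 6 ∷ []) ∷ (2 ∷ 3 ∷ 5 ∷ 6 ∷ []) ∷ (1 ∷ 7 ∷ 4 ∷ 6 ∷ []) ∷ []) ∷ ((2 ∷ 1 ∷ 5 ∷ 7 ∷ []) ∷ (2 ∷ 5 ∷ 9 ∷ 7 ∷ []) ∷ (4 ∷ 6 ∷ 10 ∷ 7 ∷ []) ∷ []) ∷ ((1 ∷ 2 ∷ 4 ∷ 8 ∷ []) ∷ (2 ∷ 3 ∷ 4 ∷ 8 ∷ []) ∷ (1 ∷ 3 ∷ 7 ∷ 8 ∷ []) ∷ []) ∷ ((2 ∷ 6 ∷ 3 ∷ 9 ∷ []) ∷ (3 ∷ 7 ∷ 1 ∷ 9 ∷ []) ∷ (2 ∷ 6 ∷ 7 ∷ 9 ∷ []) ∷ []) ∷ ((1 ∷ 3 ∷ 4 ∷ 10 ∷ []) ∷ (2 ∷ 3 ∷ 5 ∷ 10 ∷ []) ∷ (1 ∷ 7 ∷ 4 ∷ 10 ∷ []) ∷ []) ∷ []) ∷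
  (((3 ∷ 2 ∷ 6 ∷ 0 ∷ []) ∷ (3 ∷ 6 ∷ 10 ∷ 0 ∷ []) ∷ (5 ∷ 2 ∷ 4 ∷ 0 ∷ []) ∷ []) ∷ [] ∷ ((0 ∷ 4 ∷ 6 ∷ 2 ∷ []) ∷ (3 ∷ 7 ∷ 6 ∷ 2 ∷ []) ∷ (0 ∷ 4 ∷ 10 ∷ 2 ∷ []) ∷ []) ∷ ((0 ∷ 2 ∷ 5 ∷ 3 ∷ []) ∷ (2 ∷ 4 ∷ 5 ∷ 3 ∷ []) ∷ (0 ∷ 4 ∷ 7 ∷ 3 ∷ []) ∷ []) ∷ ((3 ∷ 2 ∷ 6 ∷ 4 ∷ []) ∷ (3 ∷ 6 ∷ 10 ∷ 4 ∷ []) ∷ (5 ∷ 2 ∷ 0 ∷ 4 ∷ []) ∷ []) ∷ ((0 ∷ 3 ∷ 7 ∷ 5 ∷ []) ∷ (2 ∷ 3 ∷ 7 ∷ 5 ∷ []) ∷ (0 ∷ 4 ∷ 2 ∷ 5 ∷ []) ∷ []) ∷ ((0 ∷ 4 ∷ 2 ∷ 6 ∷ []) ∷ (3 ∷ 7 ∷ 2 ∷ 6 ∷ []) ∷ (0 ∷ 4 ∷ 10 ∷ 6 ∷ []) ∷ []) ∷ ((0 ∷ 2 ∷ 5 ∷ 7 ∷ []) ∷ (2 ∷ 4 ∷ 5 ∷ 7 ∷ []) ∷ (0 ∷ 4 ∷ 3 ∷ 7 ∷ []) ∷ []) ∷ ((3 ∷ 2 ∷ 6 ∷ 8 ∷ [])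 ∷ (3 ∷ 6 ∷ 10 ∷ 8 ∷ []) ∷ (5 ∷ 2 ∷ 0 ∷ 8 ∷ []) ∷ []) ∷ ((0 ∷ 3 ∷ 7 ∷ 9 ∷ []) ∷ (2 ∷ 3 ∷ 7 ∷ 9 ∷ []) ∷ (0 ∷ 4 ∷ 2 ∷ 9 ∷ []) ∷ []) ∷ ((0 ∷ 4 ∷ 2 ∷ 10 ∷ []) ∷ (3 ∷ 7 ∷ 2 ∷ 10 ∷ []) ∷ (0 ∷ 4 ∷ 6 ∷ 10 ∷ []) ∷ []) ∷ []) ∷
  (((1 ∷ 3 ∷ 6 ∷ 0 ∷ []) ∷ (3 ∷ 5 ∷ 6 ∷ 0 ∷ []) ∷ (1 ∷ 7 ∷ 6 ∷ 0 ∷ []) ∷ (1 ∷ 3 ∷ 10 ∷ 0 ∷ []) ∷ []) ∷ ((0 ∷ 3 ∷ 5 ∷ 1 ∷ []) ∷ (4 ∷ 3 ∷ 5 ∷ 1 ∷ []) ∷ (0 ∷ 7 ∷ 5 ∷ 1 ∷ []) ∷ (0 ∷ 3 ∷ 9 ∷ 1 ∷ []) ∷ []) ∷ [] ∷ ((1 ∷ 5 ∷ 7 ∷ 3 ∷ []) ∷ (5 ∷ 9 ∷ 7 ∷ 3 ∷ []) ∷ (1 ∷ 9 ∷ 7 ∷ 3 ∷ []) ∷ (6 ∷ 0 ∷ 1 ∷ 3 ∷ []) ∷ []) ∷ ((0 ∷ 1 ∷ 3 ∷ 4 ∷ []) ∷ (1 ∷ 3 ∷ 6 ∷ 4 ∷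 []) ∷ (0 ∷ 3 ∷ 5 ∷ 4 ∷ []) ∷ (0 ∷ 1 ∷ 7 ∷ 4 ∷ []) ∷ []) ∷ ((0 ∷ 3 ∷ 1 ∷ 5 ∷ []) ∷ (4 ∷ 3 ∷ 1 ∷ 5 ∷ []) ∷ (0 ∷ 3 ∷ 9 ∷ 5 ∷ []) ∷ (0 ∷ 7 ∷ 1 ∷ 5 ∷ []) ∷ []) ∷ ((0 ∷ 4 ∷ 1 ∷ 6 ∷ []) ∷ (1 ∷ 3 ∷ 7 ∷ 6 ∷ []) ∷ (0 ∷ 4 ∷ 3 ∷ 6 ∷ []) ∷ []) ∷ ((1 ∷ 5 ∷ 3 ∷ 7 ∷ []) ∷ (5 ∷ 9 ∷ 3 ∷ 7 ∷ []) ∷ (6 ∷ 0 ∷ 1 ∷ 7 ∷ []) ∷ []) ∷ ((0 ∷ 1 ∷ 3 ∷ 8 ∷ []) ∷ (1 ∷ 3 ∷ 6 ∷ 8 ∷ []) ∷ (0 ∷ 3 ∷ 5 ∷ 8 ∷ []) ∷ (0 ∷ 1 ∷ 7 ∷ 8 ∷ []) ∷ []) ∷ ((0 ∷ 3 ∷ 1 ∷ 9 ∷ []) ∷ (4 ∷ 3 ∷ 1 ∷ 9 ∷ []) ∷ (0 ∷ 3 ∷ 5 ∷ 9 ∷ []) ∷ (0 ∷ 7 ∷ 1 ∷ 9 ∷ []) ∷ []) ∷ ((0 ∷ 4 ∷ 1 ∷ 10 ∷ []) ∷ (1 ∷ 3 ∷ 7 ∷ 10 ∷ []) ∷ (0 ∷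 4 ∷ 3 ∷ 10 ∷ []) ∷ []) ∷ []) ∷
  (((1 ∷ 5 ∷ 2 ∷ 0 ∷ []) ∷ (2 ∷ 6 ∷ 4 ∷ 0 ∷ []) ∷ (1 ∷ 5 ∷ 6 ∷ 0 ∷ []) ∷ []) ∷ ((0 ∷ 2 ∷ 7 ∷ 1 ∷ []) ∷ (2 ∷ 4 ∷ 7 ∷ 1 ∷ []) ∷ (0 ∷ 6 ∷ 7 ∷ 1 ∷ []) ∷ (5 ∷ 0 ∷ 2 ∷ 1 ∷ []) ∷ []) ∷ ((1 ∷ 0 ∷ 6 ∷ 2 ∷ []) ∷ (1 ∷ 4 ∷ 6 ∷ 2 ∷ []) ∷ (5 ∷ 0 ∷ 6 ∷ 2 ∷ []) ∷ (1 ∷ 0 ∷ 10 ∷ 2 ∷ []) ∷ []) ∷ [] ∷ ((1 ∷ 5 ∷ 2 ∷ 4 ∷ []) ∷ (2 ∷ 6 ∷ 0 ∷ 4 ∷ []) ∷ (1 ∷ 5 ∷ 6 ∷ 4 ∷ []) ∷ []) ∷ ((0 ∷ 2 ∷ 7 ∷ 5 ∷ []) ∷ (1 ∷ 2 ∷ 4 ∷ 5 ∷ []) ∷ (0 ∷ 6 ∷ 7 ∷ 5 ∷ []) ∷ []) ∷ ((1 ∷ 0 ∷ 2 ∷ 6 ∷ []) ∷ (1 ∷ 4 ∷ 2 ∷ 6 ∷ []) ∷ (5 ∷ 0 ∷ 2 ∷ 6 ∷ []) ∷ (1 ∷ 0 ∷ 10 ∷ 6 ∷ []) ∷ []) ∷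 ((0 ∷ 4 ∷ 2 ∷ 7 ∷ []) ∷ (2 ∷ 4 ∷ 8 ∷ 7 ∷ []) ∷ (0 ∷ 4 ∷ 6 ∷ 7 ∷ []) ∷ (0 ∷ 8 ∷ 2 ∷ 7 ∷ []) ∷ []) ∷ ((1 ∷ 5 ∷ 2 ∷ 8 ∷ []) ∷ (2 ∷ 6 ∷ 0 ∷ 8 ∷ []) ∷ (1 ∷ 5 ∷ 6 ∷ 8 ∷ []) ∷ []) ∷ ((0 ∷ 2 ∷ 7 ∷ 9 ∷ []) ∷ (1 ∷ 2 ∷ 4 ∷ 9 ∷ []) ∷ (0 ∷ 6 ∷ 7 ∷ 9 ∷ []) ∷ []) ∷ ((1 ∷ 0 ∷ 2 ∷ 10 ∷ []) ∷ (1 ∷ 4 ∷ 2 ∷ 10 ∷ []) ∷ (5 ∷ 0 ∷ 2 ∷ 10 ∷ []) ∷ (1 ∷ 0 ∷ 6 ∷ 10 ∷ []) ∷ []) ∷ []) ∷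
  (((1 ∷ 2 ∷ 8 ∷ 0 ∷ []) ∷ (1 ∷ 3 ∷ 7 ∷ 0 ∷ []) ∷ (2 ∷ 3 ∷ 8 ∷ 0 ∷ []) ∷ []) ∷ ((0 ∷ 2 ∷ 5 ∷ 1 ∷ []) ∷ (2 ∷ 6 ∷ 3 ∷ 1 ∷ []) ∷ (0 ∷ 6 ∷ 5 ∷ 1 ∷ []) ∷ []) ∷ ((0 ∷ 3 ∷ 7 ∷ 2 ∷ []) ∷ (1 ∷ 3 ∷ 8 ∷ 2 ∷ []) ∷ (1 ∷ 7 ∷ 0 ∷ 2 ∷ []) ∷ []) ∷ ((0 ∷ 2 ∷ 6 ∷ 3 ∷ []) ∷ (2 ∷ 1 ∷ 5 ∷ 3 ∷ []) ∷ (0 ∷ 6 ∷ 10 ∷ 3 ∷ []) ∷ []) ∷ [] ∷ ((0 ∷ 2 ∷ 1 ∷ 5 ∷ []) ∷ (2 ∷ 6 ∷ 3 ∷ 5 ∷ []) ∷ (0 ∷ 6 ∷ 1 ∷ 5 ∷ []) ∷ []) ∷ ((0 ∷ 3 ∷ 7 ∷ 6 ∷ []) ∷ (1 ∷ 3 ∷ 8 ∷ 6 ∷ []) ∷ (1 ∷ 7 ∷ 0 ∷ 6 ∷ []) ∷ []) ∷ ((0 ∷ 2 ∷ 6 ∷ 7 ∷ []) ∷ (2 ∷ 1 ∷ 5 ∷ 7 ∷ []) ∷ (0 ∷ 6 ∷ 10 ∷ 7 ∷ []) ∷ []) ∷ ((0 ∷ 1 ∷ 2 ∷ 8 ∷ [])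 ∷ (1 ∷ 3 ∷ 7 ∷ 8 ∷ []) ∷ (0 ∷ 2 ∷ 3 ∷ 8 ∷ []) ∷ []) ∷ ((0 ∷ 2 ∷ 1 ∷ 9 ∷ []) ∷ (2 ∷ 6 ∷ 3 ∷ 9 ∷ []) ∷ (0 ∷ 6 ∷ 1 ∷ 9 ∷ []) ∷ []) ∷ ((0 ∷ 3 ∷ 7 ∷ 10 ∷ []) ∷ (1 ∷ 3 ∷ 8 ∷ 10 ∷ []) ∷ (1 ∷ 7 ∷ 0 ∷ 10 ∷ []) ∷ []) ∷ []) ∷
  (((1 ∷ 2 ∷ 4 ∷ 0 ∷ []) ∷ (3 ∷ 2 ∷ 6 ∷ 0 ∷ []) ∷ (1 ∷ 3 ∷ 7 ∷ 0 ∷ []) ∷ []) ∷ ((0 ∷ 3 ∷ 7 ∷ 1 ∷ []) ∷ (2 ∷ 3 ∷ 7 ∷ 1 ∷ []) ∷ (0 ∷ 4 ∷ 2 ∷ 1 ∷ []) ∷ []) ∷ ((0 ∷ 4 ∷ 6 ∷ 2 ∷ []) ∷ (1 ∷ 3 ∷ 4 ∷ 2 ∷ []) ∷ (0 ∷ 8 ∷ 6 ∷ 2 ∷ []) ∷ []) ∷ ((0 ∷ 2 ∷ 1 ∷ 3 ∷ []) ∷ (2 ∷ 4 ∷ 1 ∷ 3 ∷ []) ∷ (0 ∷ 2 ∷ 9 ∷ 3 ∷ []) ∷ (0 ∷ 4 ∷ 7 ∷ 3 ∷ []) ∷ []) ∷ ((1 ∷ 2 ∷ 0 ∷ 4 ∷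 []) ∷ (1 ∷ 2 ∷ 8 ∷ 4 ∷ []) ∷ (3 ∷ 2 ∷ 6 ∷ 4 ∷ []) ∷ (1 ∷ 3 ∷ 7 ∷ 4 ∷ []) ∷ []) ∷ [] ∷ ((0 ∷ 4 ∷ 2 ∷ 6 ∷ []) ∷ (1 ∷ 3 ∷ 4 ∷ 6 ∷ []) ∷ (0 ∷ 8 ∷ 2 ∷ 6 ∷ []) ∷ []) ∷ ((0 ∷ 2 ∷ 1 ∷ 7 ∷ []) ∷ (2 ∷ 4 ∷ 1 ∷ 7 ∷ []) ∷ (0 ∷ 2 ∷ 9 ∷ 7 ∷ []) ∷ (0 ∷ 4 ∷ 3 ∷ 7 ∷ []) ∷ []) ∷ ((1 ∷ 2 ∷ 0 ∷ 8 ∷ []) ∷ (1 ∷ 2 ∷ 4 ∷ 8 ∷ []) ∷ (3 ∷ 2 ∷ 6 ∷ 8 ∷ []) ∷ (1 ∷ 3 ∷ 7 ∷ 8 ∷ []) ∷ []) ∷ ((0 ∷ 3 ∷ 7 ∷ 9 ∷ []) ∷ (2 ∷ 3 ∷ 7 ∷ 9 ∷ []) ∷ (0 ∷ 4 ∷ 2 ∷ 9 ∷ []) ∷ []) ∷ ((0 ∷ 4 ∷ 2 ∷ 10 ∷ []) ∷ (1 ∷ 3 ∷ 4 ∷ 10 ∷ []) ∷ (0 ∷ 8 ∷ 2 ∷ 10 ∷ []) ∷ []) ∷ []) ∷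
  (((1 ∷ 3 ∷ 2 ∷ 0 ∷ []) ∷ (3 ∷ 5 ∷ 2 ∷ 0 ∷ []) ∷ (1 ∷ 3 ∷ 10 ∷ 0 ∷ []) ∷ (1 ∷ 7 ∷ 2 ∷ 0 ∷ []) ∷ []) ∷ ((0 ∷ 3 ∷ 5 ∷ 1 ∷ []) ∷ (2 ∷ 3 ∷ 7 ∷ 1 ∷ []) ∷ (0 ∷ 7 ∷ 5 ∷ 1 ∷ []) ∷ []) ∷ ((0 ∷ 4 ∷ 1 ∷ 2 ∷ []) ∷ (1 ∷ 3 ∷ 7 ∷ 2 ∷ []) ∷ (0 ∷ 4 ∷ 3 ∷ 2 ∷ []) ∷ []) ∷ ((1 ∷ 5 ∷ 7 ∷ 3 ∷ []) ∷ (2 ∷ 0 ∷ 5 ∷ 3 ∷ []) ∷ (1 ∷ 9 ∷ 7 ∷ 3 ∷ []) ∷ []) ∷ ((0 ∷ 1 ∷ 3 ∷ 4 ∷ []) ∷ (1 ∷ 3 ∷ 2 ∷ 4 ∷ []) ∷ (0 ∷ 3 ∷ 5 ∷ 4 ∷ []) ∷ (0 ∷ 1 ∷ 7 ∷ 4 ∷ []) ∷ []) ∷ ((0 ∷ 3 ∷ 1 ∷ 5 ∷ []) ∷ (2 ∷ 3 ∷ 7 ∷ 5 ∷ []) ∷ (0 ∷ 7 ∷ 1 ∷ 5 ∷ []) ∷ []) ∷ [] ∷ ((1 ∷ 5 ∷ 3 ∷ 7 ∷ []) ∷ (2 ∷ 0 ∷ 5 ∷ 7 ∷ []) ∷ (1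 ∷ 9 ∷ 3 ∷ 7 ∷ []) ∷ []) ∷ ((0 ∷ 1 ∷ 3 ∷ 8 ∷ []) ∷ (1 ∷ 3 ∷ 2 ∷ 8 ∷ []) ∷ (0 ∷ 3 ∷ 5 ∷ 8 ∷ []) ∷ (0 ∷ 1 ∷ 7 ∷ 8 ∷ []) ∷ []) ∷ ((0 ∷ 3 ∷ 1 ∷ 9 ∷ []) ∷ (2 ∷ 3 ∷ 7 ∷ 9 ∷ []) ∷ (0 ∷ 7 ∷ 1 ∷ 9 ∷ []) ∷ []) ∷ ((0 ∷ 4 ∷ 1 ∷ 10 ∷ []) ∷ (1 ∷ 3 ∷ 7 ∷ 10 ∷ []) ∷ (0 ∷ 4 ∷ 3 ∷ 10 ∷ []) ∷ []) ∷ []) ∷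
  (((1 ∷ 5 ∷ 2 ∷ 0 ∷ []) ∷ (2 ∷ 6 ∷ 4 ∷ 0 ∷ []) ∷ (1 ∷ 5 ∷ 6 ∷ 0 ∷ []) ∷ []) ∷ ((0 ∷ 2 ∷ 3 ∷ 1 ∷ []) ∷ (2 ∷ 4 ∷ 3 ∷ 1 ∷ []) ∷ (0 ∷ 6 ∷ 3 ∷ 1 ∷ []) ∷ (5 ∷ 0 ∷ 2 ∷ 1 ∷ []) ∷ []) ∷ ((1 ∷ 0 ∷ 6 ∷ 2 ∷ []) ∷ (1 ∷ 4 ∷ 6 ∷ 2 ∷ []) ∷ (3 ∷ 5 ∷ 9 ∷ 2 ∷ []) ∷ []) ∷ ((0 ∷ 4 ∷ 2 ∷ 3 ∷ []) ∷ (2 ∷ 4 ∷ 8 ∷ 3 ∷ []) ∷ (0 ∷ 4 ∷ 6 ∷ 3 ∷ []) ∷ (0 ∷ 8 ∷ 2 ∷ 3 ∷ []) ∷ []) ∷ ((1 ∷ 5 ∷ 2 ∷ 4 ∷ []) ∷ (2 ∷ 6 ∷ 0 ∷ 4 ∷ []) ∷ (1 ∷ 5 ∷ 6 ∷ 4 ∷ []) ∷ []) ∷ ((0 ∷ 2 ∷ 3 ∷ 5 ∷ []) ∷ (1 ∷ 2 ∷ 4 ∷ 5 ∷ []) ∷ (0 ∷ 6 ∷ 3 ∷ 5 ∷ []) ∷ []) ∷ ((1 ∷ 0 ∷ 2 ∷ 6 ∷ []) ∷ (1 ∷ 4 ∷ 2 ∷ 6 ∷ []) ∷ (3 ∷ 5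 ∷ 9 ∷ 6 ∷ []) ∷ []) ∷ [] ∷ ((1 ∷ 5 ∷ 2 ∷ 8 ∷ []) ∷ (2 ∷ 6 ∷ 0 ∷ 8 ∷ []) ∷ (1 ∷ 5 ∷ 6 ∷ 8 ∷ []) ∷ []) ∷ ((0 ∷ 2 ∷ 3 ∷ 9 ∷ []) ∷ (1 ∷ 2 ∷ 4 ∷ 9 ∷ []) ∷ (0 ∷ 6 ∷ 3 ∷ 9 ∷ []) ∷ []) ∷ ((1 ∷ 0 ∷ 2 ∷ 10 ∷ []) ∷ (1 ∷ 4 ∷ 2 ∷ 10 ∷ []) ∷ (3 ∷ 5 ∷ 9 ∷ 10 ∷ []) ∷ []) ∷ []) ∷
  (((1 ∷ 2 ∷ 4 ∷ 0 ∷ []) ∷ (2 ∷ 3 ∷ 4 ∷ 0 ∷ []) ∷ (1 ∷ 3 ∷ 7 ∷ 0 ∷ []) ∷ []) ∷ ((0 ∷ 2 ∷ 5 ∷ 1 ∷ []) ∷ (2 ∷ 6 ∷ 3 ∷ 1 ∷ []) ∷ (0 ∷ 6 ∷ 5 ∷ 1 ∷ []) ∷ []) ∷ ((0 ∷ 3 ∷ 7 ∷ 2 ∷ []) ∷ (1 ∷ 3 ∷ 4 ∷ 2 ∷ []) ∷ (1 ∷ 7 ∷ 0 ∷ 2 ∷ []) ∷ []) ∷ ((0 ∷ 2 ∷ 6 ∷ 3 ∷ []) ∷ (2 ∷ 1 ∷ 5 ∷ 3 ∷ []) ∷ (0 ∷ 6 ∷ 10 ∷ 3 ∷ []) ∷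 []) ∷ ((0 ∷ 1 ∷ 2 ∷ 4 ∷ []) ∷ (1 ∷ 3 ∷ 7 ∷ 4 ∷ []) ∷ (0 ∷ 2 ∷ 3 ∷ 4 ∷ []) ∷ []) ∷ ((0 ∷ 2 ∷ 1 ∷ 5 ∷ []) ∷ (2 ∷ 6 ∷ 3 ∷ 5 ∷ []) ∷ (0 ∷ 6 ∷ 1 ∷ 5 ∷ []) ∷ []) ∷ ((0 ∷ 3 ∷ 7 ∷ 6 ∷ []) ∷ (1 ∷ 3 ∷ 4 ∷ 6 ∷ []) ∷ (1 ∷ 7 ∷ 0 ∷ 6 ∷ []) ∷ []) ∷ ((0 ∷ 2 ∷ 6 ∷ 7 ∷ []) ∷ (2 ∷ 1 ∷ 5 ∷ 7 ∷ []) ∷ (0 ∷ 6 ∷ 10 ∷ 7 ∷ []) ∷ []) ∷ [] ∷ ((0 ∷ 2 ∷ 1 ∷ 9 ∷ []) ∷ (2 ∷ 6 ∷ 3 ∷ 9 ∷ []) ∷ (0 ∷ 6 ∷ 1 ∷ 9 ∷ []) ∷ []) ∷ ((0 ∷ 3 ∷ 7 ∷ 10 ∷ []) ∷ (1 ∷ 3 ∷ 4 ∷ 10 ∷ []) ∷ (1 ∷ 7 ∷ 0 ∷ 10 ∷ []) ∷ []) ∷ []) ∷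
  (((1 ∷ 2 ∷ 4 ∷ 0 ∷ []) ∷ (3 ∷ 2 ∷ 6 ∷ 0 ∷ []) ∷ (1 ∷ 3 ∷ 7 ∷ 0 ∷ []) ∷ []) ∷ ((0 ∷ 3 ∷ 7 ∷ 1 ∷ []) ∷ (2 ∷ 3 ∷ 7 ∷ 1 ∷ []) ∷ (0 ∷ 4 ∷ 2 ∷ 1 ∷ []) ∷ []) ∷ ((0 ∷ 4 ∷ 6 ∷ 2 ∷ []) ∷ (1 ∷ 3 ∷ 4 ∷ 2 ∷ []) ∷ (0 ∷ 8 ∷ 6 ∷ 2 ∷ []) ∷ []) ∷ ((0 ∷ 2 ∷ 1 ∷ 3 ∷ []) ∷ (2 ∷ 4 ∷ 1 ∷ 3 ∷ []) ∷ (0 ∷ 2 ∷ 5 ∷ 3 ∷ []) ∷ (0 ∷ 4 ∷ 7 ∷ 3 ∷ []) ∷ []) ∷ ((1 ∷ 2 ∷ 0 ∷ 4 ∷ []) ∷ (1 ∷ 2 ∷ 8 ∷ 4 ∷ []) ∷ (3 ∷ 2 ∷ 6 ∷ 4 ∷ []) ∷ (1 ∷ 3 ∷ 7 ∷ 4 ∷ []) ∷ []) ∷ ((0 ∷ 3 ∷ 7 ∷ 5 ∷ []) ∷ (2 ∷ 3 ∷ 7 ∷ 5 ∷ []) ∷ (0 ∷ 4 ∷ 2 ∷ 5 ∷ []) ∷ []) ∷ ((0 ∷ 4 ∷ 2 ∷ 6 ∷ []) ∷ (1 ∷ 3 ∷ 4 ∷ 6 ∷ []) ∷ (0 ∷ 8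 ∷ 2 ∷ 6 ∷ []) ∷ []) ∷ ((0 ∷ 2 ∷ 1 ∷ 7 ∷ []) ∷ (2 ∷ 4 ∷ 1 ∷ 7 ∷ []) ∷ (0 ∷ 2 ∷ 5 ∷ 7 ∷ []) ∷ (0 ∷ 4 ∷ 3 ∷ 7 ∷ []) ∷ []) ∷ ((1 ∷ 2 ∷ 0 ∷ 8 ∷ []) ∷ (1 ∷ 2 ∷ 4 ∷ 8 ∷ []) ∷ (3 ∷ 2 ∷ 6 ∷ 8 ∷ []) ∷ (1 ∷ 3 ∷ 7 ∷ 8 ∷ []) ∷ []) ∷ [] ∷ ((0 ∷ 4 ∷ 2 ∷ 10 ∷ []) ∷ (1 ∷ 3 ∷ 4 ∷ 10 ∷ []) ∷ (0 ∷ 8 ∷ 2 ∷ 10 ∷ []) ∷ []) ∷ []) ∷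
  (((1 ∷ 3 ∷ 2 ∷ 0 ∷ []) ∷ (3 ∷ 5 ∷ 2 ∷ 0 ∷ []) ∷ (1 ∷ 3 ∷ 6 ∷ 0 ∷ []) ∷ (1 ∷ 7 ∷ 2 ∷ 0 ∷ []) ∷ []) ∷ ((0 ∷ 3 ∷ 5 ∷ 1 ∷ []) ∷ (2 ∷ 3 ∷ 7 ∷ 1 ∷ []) ∷ (0 ∷ 7 ∷ 5 ∷ 1 ∷ []) ∷ []) ∷ ((0 ∷ 4 ∷ 1 ∷ 2 ∷ []) ∷ (1 ∷ 3 ∷ 7 ∷ 2 ∷ []) ∷ (0 ∷ 4 ∷ 3 ∷ 2 ∷ []) ∷ []) ∷ ((1 ∷ 5 ∷ 7 ∷ 3 ∷ []) ∷ (2 ∷ 0 ∷ 5 ∷ 3 ∷ []) ∷ (1 ∷ 9 ∷ 7 ∷ 3 ∷ []) ∷ []) ∷ ((0 ∷ 1 ∷ 3 ∷ 4 ∷ []) ∷ (1 ∷ 3 ∷ 2 ∷ 4 ∷ []) ∷ (0 ∷ 3 ∷ 5 ∷ 4 ∷ []) ∷ (0 ∷ 1 ∷ 7 ∷ 4 ∷ []) ∷ []) ∷ ((0 ∷ 3 ∷ 1 ∷ 5 ∷ []) ∷ (2 ∷ 3 ∷ 7 ∷ 5 ∷ []) ∷ (0 ∷ 7 ∷ 1 ∷ 5 ∷ []) ∷ []) ∷ ((0 ∷ 4 ∷ 1 ∷ 6 ∷ []) ∷ (1 ∷ 3 ∷ 7 ∷ 6 ∷ []) ∷ (0 ∷ 4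 ∷ 3 ∷ 6 ∷ []) ∷ []) ∷ ((1 ∷ 5 ∷ 3 ∷ 7 ∷ []) ∷ (2 ∷ 0 ∷ 5 ∷ 7 ∷ []) ∷ (1 ∷ 9 ∷ 3 ∷ 7 ∷ []) ∷ []) ∷ ((0 ∷ 1 ∷ 3 ∷ 8 ∷ []) ∷ (1 ∷ 3 ∷ 2 ∷ 8 ∷ []) ∷ (0 ∷ 3 ∷ 5 ∷ 8 ∷ []) ∷ (0 ∷ 1 ∷ 7 ∷ 8 ∷ []) ∷ []) ∷ ((0 ∷ 3 ∷ 1 ∷ 9 ∷ []) ∷ (2 ∷ 3 ∷ 7 ∷ 9 ∷ []) ∷ (0 ∷ 7 ∷ 1 ∷ 9 ∷ []) ∷ []) ∷ [] ∷ []) ∷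
  []

module Table₃,₆ = PathTable (residueColouring pattern₃) paths₃,₆
module Table₃,₇ = PathTable (residueColouring pattern₃) paths₃,₇
module Table₃,₈ = PathTable (residueColouring pattern₃) paths₃,₈
module Table₄,₉ = PathTable (residueColouring pattern₄) paths₄,₉
module Table₄,₁₀ = PathTable (residueColouring pattern₄) paths₄,₁₀
module Table₄,₁₁ = PathTable (residueColouring pattern₄) paths₄,₁₁

residueBlowUp : {k : ℕ} → SplitWalkDesign r m → .{{_ : NonZero m}} → m * suc k ≤ n → CompleteIsCanceling n r k
residueBlowUp D bound = blowUp (SplitWalkDesign.design D) (residueClassMap bound)

canceling₃,₂ : ∀ i → CompleteIsCanceling (6 + i) 3 2
canceling₃,₂ 0                   = Table₃,₆.canceling (from-yes Table₃,₆.robust?)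
canceling₃,₂ 1                   = Table₃,₇.canceling (from-yes Table₃,₇.robust?)
canceling₃,₂ 2                   = Table₃,₈.canceling (from-yes Table₃,₈.robust?)
canceling₃,₂ (suc (suc (suc i))) = residueBlowUp design₃ (ℕ.m≤m+n 9 i)

canceling₄,₂ : ∀ i → CompleteIsCanceling (9 + i) 4 2
canceling₄,₂ 0                   = Table₄,₉.canceling (from-yes Table₄,₉.robust?)
canceling₄,₂ 1                   = Table₄,₁₀.canceling (from-yes Table₄,₁₀.robust?)
canceling₄,₂ 2                   = Table₄,₁₁.canceling (from-yes Table₄,₁₁.robust?)
canceling₄,₂ (suc (suc (suc i))) = residueBlowUp design₄ (ℕ.m≤m+n 12 i)

m+n≡o⇒m≤o : ∀ m n {o} → m + n ≡ o → m ≤ o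
m+n≡o⇒m≤o m n m+n≡o = subst (m ≤_) m+n≡o (ℕ.m≤m+n m n)

bound₃ : ∀ j → 3 * (4 + j) ≤ 3 * ((2 + j) * 2)
bound₃ j = m+n≡o⇒m≤o (3 * (4 + j)) (3 * j) (identity j)
  where identity : ∀ j → 3 * (4 + j) + 3 * j ≡ 3 * ((2 + j) * 2)
        identity = solve-∀

bound₄ : ∀ j → 4 * (4 + j) ≤ 3 * ((2 + j) * 3)
bound₄ j = m+n≡o⇒m≤o (4 * (4 + j)) (2 + 5 * j) (identity j)
  where identity : ∀ j → 4 * (4 + j) + (2 + 5 * j) ≡ 3 * ((2 + j) * 3)
        identity = solve-∀

bound₅₊ : ∀ m j → m * (3 + j) ≤ 3 * ((1 + j) * m)
bound₅₊ m j = m+n≡o⇒m≤o (m * (3 + j)) (2 * j * m) (identity m j)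
  where identity : ∀ m j → m * (3 + j) + 2 * j * m ≡ 3 * ((1 + j) * m)
        identity = solve-∀

proposition5p2 : (r k n : ℕ) → 3 ≤ r → 2 ≤ k → 3 * ((k ∸ 1) * (r ∸ 1)) ≤ n →
    CompleteIsCanceling n r k
proposition5p2 0 _ _ () _ _
proposition5p2 1 _ _ (s≤s ()) _ _
proposition5p2 2 _ _ (s≤s (s≤s ())) _ _
proposition5p2 _ 0 _ _ () _
proposition5p2 _ 1 _ _ (s≤s ()) _
proposition5p2 3 2 n _ _ 6≤n with i , refl ← ℕ.m≤n⇒∃[o]m+o≡n 6≤n = canceling₃,₂ i
proposition5p2 4 2 n _ _ 9≤n with i , refl ← ℕ.m≤n⇒∃[o]m+o≡n 9≤n = canceling₄,₂ i
proposition5p2 3 (suc (suc (suc j))) n _ _ bound = residueBlowUp design₃ (ℕ.≤-trans (bound₃ j) bound)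
proposition5p2 4 (suc (suc (suc j))) n _ _ bound = residueBlowUp design₄ (ℕ.≤-trans (bound₄ j) bound)
proposition5p2 (suc (suc (suc (suc (suc t))))) (suc (suc j)) n _ _ bound =
  residueBlowUp (design₅₊ t) (ℕ.≤-trans (bound₅₊ (4 + t) j) bound)
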